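{- For distinct $a,b,c\in[5]$, the facet of the BME polytope $\mathcal{P}_5$ given as the convex hull of the points $x(t)$ over binary trees $t$ on $[5]$ having the cherry $\{a,b\}$ or the cherry $\{b,c\}$ is combinatorially equivalent (has isomorphic face lattice) to the 4-dimensional Birkhoff polytope $B(3)$, the convex hull of the six $3\times 3$ permutation matrices.
   Context: A binary tree on leaf set $[n]$ is a tree whose vertices have degree 1 (leaves, labeled bijectively by $[n]$) or degree 3. For such $t$, $x(t)\in\mathbb{R}^{\binom n2}$ has coordinates $x_{ij}(t)=2^{\,n-2-l_{ij}}$, where $l_{ij}$ is the number of internal nodes on the path between leaves $i$ and $j$. The BME polytope $\mathcal{P}_n$ is the convex hull of all $x(t)$. A cherry is a pair of leaves adjacent to a common internal node. -}

module Defs where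

open import Data.Bool using (Bool; true; false; if_then_else_)
open import Data.Nat as ℕ using (ℕ; _∸_; _^_)
open import Data.Integer using (+_)
open import Data.Rational using (ℚ; _≤_; _/_; _*_; _+_; 0ℚ; 1ℚ)
open import Data.Fin using (Fin) renaming (_<_ to _<ᶠ_)
open import Data.Fin.Properties using () renaming (_<?_ to _<ᶠ?_)
open import Data.Fin.Permutation using (Permutation′; _⟨$⟩ʳ_)
open import Data.List using (List; []; _∷_; map; filterᵇ; filter; length; _++_; allFin; concatMap; foldr)
open import Data.List.Relation.Unary.Unique.Propositional using (Unique)
open import Data.Product using (Σ; _×_; _,_; ∃-syntax)
open import Data.Sum using (_⊎_; inj₁; inj₂)
open import Relation.Binary.PropositionalEquality using (_≡_; _≢_)
open import Relation.Nullary.Decidable using (does)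

-- Graphs with leaf vertices Fin n and internal vertices Fin m

Vtx : ℕ → ℕ → Set
Vtx n m = Fin n ⊎ Fin m

allVtx : (n m : ℕ) → List (Vtx n m)
allVtx n m = map inj₁ (allFin n) ++ map inj₂ (allFin m)

data Walk {V : Set} (E : V → V → Bool) : V → V → Set where
  here : (u : V) → Walk E u u
  step : {u w v : V} → E u w ≡ true → Walk E w v → Walk E u v

verts : {V : Set} {E : V → V → Bool} {u v : V} → Walk E u v → List V
verts (here u) = u ∷ []
verts (step {u = u} _ p) = u ∷ verts p

Path : {V : Set} (E : V → V → Bool) → V → V → Set
Path E u v = Σ (Walk E u v) (λ p → Unique (verts p))

degree : {n m : ℕ} → (Vtx n m → Vtx n m → Bool) → Vtx n m → ℕ
degree {n} {m} E v = length (filterᵇ (E v) (allVtx n m))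

record BinTree (n : ℕ) : Set where
  field
    m         : ℕ
    adj       : Vtx n m → Vtx n m → Bool
    adj-sym   : ∀ u v → adj u v ≡ adj v u
    adj-irr   : ∀ u → adj u u ≡ false
    leaf-deg  : ∀ i → degree adj (inj₁ i) ≡ 1
    int-deg   : ∀ k → degree adj (inj₂ k) ≡ 3
    path      : ∀ u v → Path adj u v
    path-uniq : ∀ u v (p q : Path adj u v) →
                verts (Data.Product.proj₁ p) ≡ verts (Data.Product.proj₁ q)

open BinTree public

isInternal : {n m : ℕ} → Vtx n m → Bool
isInternal (inj₁ _) = false
isInternal (inj₂ _) = true

ℓ : {n : ℕ} (t : BinTree n) → Fin n → Fin n → ℕ
ℓ t i j = length (filterᵇ isInternal (verts (Data.Product.proj₁ (path t (inj₁ i) (inj₁ j)))))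

Cherry : {n : ℕ} (t : BinTree n) → Fin n → Fin n → Set
Cherry t a b = ∃[ u ] (adj t (inj₁ a) (inj₂ u) ≡ true × adj t (inj₁ b) (inj₂ u) ≡ true)

ℕ→ℚ : ℕ → ℚ
ℕ→ℚ k = (+ k) / 1

-- x(t) ∈ ℝ^{n choose 2}: coordinates indexed by pairs i < j
xvec : {n : ℕ} → BinTree n → Fin n × Fin n → ℚ
xvec {n} t (i , j) = ℕ→ℚ (2 ^ (n ∸ 2 ∸ ℓ t i j))

pairs< : (n : ℕ) → List (Fin n × Fin n)
pairs< n = filter (λ p → Data.Product.proj₁ p <ᶠ? Data.Product.proj₂ p)
                  (concatMap (λ i → map (λ j → (i , j)) (allFin n)) (allFin n))

pairsAll : (n : ℕ) → List (Fin n × Fin n)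
pairsAll n = concatMap (λ i → map (λ j → (i , j)) (allFin n)) (allFin n)

-- Faces of the polytope conv{ X i | i ∈ I } ⊆ ℚ^K (coordinates listed by cs)

dot : {K : Set} → List K → (K → ℚ) → (K → ℚ) → ℚ
dot cs c v = foldr (λ k s → c k * v k + s) 0ℚ cs

-- a valid inequality c·x ≤ δ for the polytope; its face is the set of
-- points on the hyperplane c·x = δ (this covers the empty face and the
-- polytope itself)
record Face {I K : Set} (cs : List K) (X : I → K → ℚ) : Set where
  field
    c     : K → ℚ
    δ     : ℚ
    valid : ∀ i → dot cs c (X i) ≤ δ

On : {I K : Set} {cs : List K} {X : I → K → ℚ} → Face cs X → I → Set
On {cs = cs} {X} F i = dot cs (Face.c F) (X i) ≡ Face.δ F

-- inclusion of faces (a face is the convex hull of the generators on it)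
_⊑_ : {I K : Set} {cs : List K} {X : I → K → ℚ} → Face cs X → Face cs X → Set
F ⊑ G = ∀ i → On F i → On G i

_≈F_ : {I K : Set} {cs : List K} {X : I → K → ℚ} → Face cs X → Face cs X → Set
F ≈F G = (F ⊑ G) × (G ⊑ F)

CombEquiv : {I K J L : Set} (cs : List K) (X : I → K → ℚ)
            (ds : List L) (Y : J → L → ℚ) → Set
CombEquiv cs X ds Y =
  Σ (Face cs X → Face ds Y) λ f →
  Σ (Face ds Y → Face cs X) λ g →
    (∀ F G → F ⊑ G → f F ⊑ f G) ×
    (∀ F G → F ⊑ G → g F ⊑ g G) ×
    (∀ F → g (f F) ≈F F) ×
    (∀ G → f (g G) ≈F G)

FacetTrees : Fin 5 → Fin 5 → Fin 5 → Set
FacetTrees a b c = Σ (BinTree 5) (λ t → Cherry t a b ⊎ Cherry t b c)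

facetPts : (a b c : Fin 5) → FacetTrees a b c → Fin 5 × Fin 5 → ℚ
facetPts a b c (t , _) = xvec t

permMatrix : Permutation′ 3 → Fin 3 × Fin 3 → ℚ
permMatrix π (i , j) = if does ((π ⟨$⟩ʳ i) Data.Fin.≟ j) then 1ℚ else 0ℚ

-- A tree with the cherry {a,b} is a caterpillar ab|y|de: exploring it from the
-- cherry node, a leaf met too early would leave a connected component with fewer
-- than five leaves, and any further branching would produce six distinct leaves.
-- Hence the facet has exactly six points, x(t) for the caterpillars with cherry
-- {a,b} or {b,c}.  Labelled by the even and odd permutations of three letters they
-- satisfy the affine dependency of B(3) and nine valid inequalities whose tight
-- sets are those of the facets of B(3).  For any polytope with such data a face is
-- determined by its set of tight vertices, these sets are exactly the sets closed
-- under the dependency, and each is cut out by the sum of the facets containing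
-- it; so both face lattices are isomorphic to the same lattice of vertex sets.

module Submission where

open import Defs
open import Algebra.Bundles using (CommutativeMonoid)
open import Data.Bool using (Bool; true; false; T; T?; not; _∧_; _∨_; if_then_else_)
open import Data.Bool.Properties as Boolₚ using (T-≡; ∨-comm; ∨-zeroʳ)
open import Data.Empty using (⊥; ⊥-elim)
open import Data.Fin using (Fin; zero; suc; #_; _↑ˡ_; _↑ʳ_)
import Data.Fin.Properties as Finₚ
open import Data.Fin.Permutation using (Permutation′; _⟨$⟩ʳ_; _⟨$⟩ˡ_; inverseˡ; permutation)
open import Data.Fin.Subset using (Subset)
open import Data.List
  using (List; []; _∷_; _++_; [_]; foldr; length; filter; filterᵇ; map; allFin; cartesianProduct)
open import Data.List.Properties
  using (filter-notAll; length-tabulate; length-++; ++-assoc; ∷-injectiveˡ; ∷-injectiveʳ)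
open import Data.List.Membership.Propositional using (_∈_; _∉_)
open import Data.List.Membership.Propositional.Properties
  using (∈-filter⁺; ∈-filter⁻; ∈-allFin; ∈-map⁺; ∈-map⁻; ∈-++⁺ˡ; ∈-++⁺ʳ; ∈-++⁻)
open import Data.List.Membership.DecPropositional (Finₚ._≟_ {5}) using (_∈?_)
open import Data.List.Relation.Binary.Subset.Propositional using (_⊆_)
open import Data.List.Relation.Unary.All as All using (All; []; _∷_)
open import Data.List.Relation.Unary.All.Properties using (¬Any⇒All¬; All¬⇒¬Any; ++⁻ʳ)
open import Data.List.Relation.Unary.Any as Any using (here; there)
open import Data.List.Relation.Unary.AllPairs using ([]; _∷_)
open import Data.List.Relation.Unary.Unique.Propositional using (Unique)
import Data.List.Relation.Unary.Unique.Propositional.Properties as Uniqueₚ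
open import Data.Nat as ℕ using (ℕ; zero; suc; z≤n; s≤s; z<s; _∸_; _^_)
import Data.Nat.Properties as ℕₚ
open import Data.Product using (Σ; ∃; _×_; _,_; proj₁; proj₂)
open import Data.Product.Properties using () renaming (≡-dec to ×-≡-dec)
open import Data.Rational using (ℚ; 0ℚ; 1ℚ; _+_; _*_; _-_; -_; _≤_)
import Data.Rational.Properties as ℚₚ
open import Algebra.Properties.Group ℚₚ.+-0-group using (∙-cancelˡ)
open import Algebra.Properties.CommutativeSemigroup
  (CommutativeMonoid.commutativeSemigroup ℚₚ.+-0-commutativeMonoid) using (interchange)
open import Data.Sum as Sum using (_⊎_; inj₁; inj₂)
import Data.Sum.Properties as Sumₚ
open Sumₚ using (inj₁-injective; inj₂-injective)
open import Data.Unit using (⊤; tt)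
open import Data.Vec using (Vec; []; _∷_; lookup; tabulate)
open import Data.Vec.Properties using (lookup∘tabulate)
open import Function using (_∘_; case_of_; _⇔_; mk⇔)
open import Function.Bundles using (Equivalence)
open import Function.Construct.Composition using (_⇔-∘_)
open import Function.Construct.Symmetry using (⇔-sym)
open import Relation.Binary.Definitions using (DecidableEquality; tri<; tri≈; tri>)
open import Relation.Binary.PropositionalEquality hiding ([_])
open import Relation.Nullary using (¬_; Dec; yes; no; ¬?; contradiction)
open import Relation.Nullary.Decidable using (does; dec-true; map′; _×-dec_; _→-dec_; from-yes)

module _ {A : Set} (_≟_ : DecidableEquality A) where

  Unique⇒length≤ : {xs ys : List A} → Unique xs → xs ⊆ ys → length xs ℕ.≤ length ys
  Unique⇒length≤ {[]} _ _ = z≤n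
  Unique⇒length≤ {x ∷ xs} {ys} (x∉xs ∷ xs!) x∷xs⊆ys =
    ℕₚ.≤-trans (s≤s (Unique⇒length≤ xs! xs⊆ys-x))
            (filter-notAll (λ y → ¬? (y ≟ x)) ys
              (Any.map (λ x≡y y≢x → y≢x (sym x≡y)) (x∷xs⊆ys (here refl))))
    where
    xs⊆ys-x : xs ⊆ filter (λ y → ¬? (y ≟ x)) ys
    xs⊆ys-x z∈xs = ∈-filter⁺ (λ y → ¬? (y ≟ x)) (x∷xs⊆ys (there z∈xs))
                     (λ z≡x → All.lookup x∉xs z∈xs (sym z≡x))

Unique⇒length≤n : ∀ {n} {xs : List (Fin n)} → Unique xs → length xs ℕ.≤ n
Unique⇒length≤n {n} {xs} xs! =
  subst (length xs ℕ.≤_) (length-tabulate {n = n} (λ i → i))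
        (Unique⇒length≤ Finₚ._≟_ xs! (λ {i} _ → ∈-allFin i))

covering⇒length≥n : ∀ {n} (xs : List (Fin n)) → (∀ i → i ∈ xs) → n ℕ.≤ length xs
covering⇒length≥n {n} xs covers =
  subst (ℕ._≤ length xs) (length-tabulate {n = n} (λ i → i))
        (Unique⇒length≤ Finₚ._≟_ (Uniqueₚ.allFin⁺ n) (λ {i} _ → covers i))

dec-true⁻¹ : ∀ {P : Set} (P? : Dec P) → does P? ≡ true → P
dec-true⁻¹ (yes p) _ = p

T-does⇔ : ∀ {P : Set} (P? : Dec P) → T (does P?) ⇔ P
T-does⇔ (yes p) = mk⇔ (λ _ → p) (λ _ → tt)
T-does⇔ (no ¬p) = mk⇔ (λ ()) ¬p

_≟ᵥ_ : ∀ {n m} → DecidableEquality (Vtx n m)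
_≟ᵥ_ = Sumₚ.≡-dec Finₚ._≟_ Finₚ._≟_

Unique-suffix : ∀ {A : Set} (pre : List A) {xs} → Unique (pre ++ xs) → Unique xs
Unique-suffix []        xs!       = xs!
Unique-suffix (_ ∷ pre) (_ ∷ xs!) = Unique-suffix pre xs!

++-suffix-≡ : ∀ {A : Set} {xs ys P Q : List A} → length P ≡ length Q → xs ++ P ≡ ys ++ Q → P ≡ Q
++-suffix-≡ {xs = xs} {ys} {P} {Q} |P|≡|Q| eq = go xs ys |xs|≡|ys| eq
  where
  |xs|≡|ys| : length xs ≡ length ys
  |xs|≡|ys| = ℕₚ.+-cancelʳ-≡ (length P) (length xs) (length ys) (begin
    length xs ℕ.+ length P ≡⟨ sym (length-++ xs) ⟩
    length (xs ++ P)       ≡⟨ cong length eq ⟩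
    length (ys ++ Q)       ≡⟨ length-++ ys ⟩
    length ys ℕ.+ length Q ≡⟨ cong (length ys ℕ.+_) (sym |P|≡|Q|) ⟩
    length ys ℕ.+ length P ∎)
    where open ≡-Reasoning
  go : ∀ xs ys → length xs ≡ length ys → xs ++ P ≡ ys ++ Q → P ≡ Q
  go []       []       _ eq = eq
  go (_ ∷ xs) (_ ∷ ys) l eq = go xs ys (ℕₚ.suc-injective l) (∷-injectiveʳ eq)

∈-allVtx : ∀ {n m} (v : Vtx n m) → v ∈ allVtx n m
∈-allVtx {n} (inj₁ i) = ∈-++⁺ˡ (∈-map⁺ inj₁ (∈-allFin i))
∈-allVtx {n} (inj₂ k) = ∈-++⁺ʳ (map inj₁ (allFin n)) (∈-map⁺ inj₂ (∈-allFin k))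

allVtx-unique : ∀ {n m} → Unique (allVtx n m)
allVtx-unique {n} {m} =
  Uniqueₚ.++⁺ (Uniqueₚ.map⁺ inj₁-injective (Uniqueₚ.allFin⁺ n))
              (Uniqueₚ.map⁺ inj₂-injective (Uniqueₚ.allFin⁺ m))
              (λ (i∈ , k∈) → leaf≢node (proj₂ (proj₂ (∈-map⁻ inj₁ i∈))) (proj₂ (proj₂ (∈-map⁻ inj₂ k∈))))
  where
  leaf≢node : ∀ {v : Vtx n m} {i k} → v ≡ inj₁ i → v ≡ inj₂ k → ⊥
  leaf≢node refl ()

internals : ∀ {n m} → List (Vtx n m) → ℕ
internals vs = length (filterᵇ isInternal vs)

internals-map₂ : ∀ {n m m′} (f : Fin m → Fin m′) (vs : List (Vtx n m)) →
                 internals (map (Sum.map₂ f) vs) ≡ internals vs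
internals-map₂ f []            = refl
internals-map₂ f (inj₁ _ ∷ vs) = internals-map₂ f vs
internals-map₂ f (inj₂ _ ∷ vs) = cong suc (internals-map₂ f vs)

module _ {V V′ : Set} {E : V → V → Bool} {E′ : V′ → V′ → Bool} (φ : V → V′)
         (φ-edge : ∀ {u v} → E u v ≡ true → E′ (φ u) (φ v) ≡ true) where

  mapWalk : ∀ {u v} → Walk E u v → Walk E′ (φ u) (φ v)
  mapWalk (here u)   = here (φ u)
  mapWalk (step e p) = step (φ-edge e) (mapWalk p)

  verts-mapWalk : ∀ {u v} (p : Walk E u v) → verts (mapWalk p) ≡ map φ (verts p)
  verts-mapWalk (here u)   = refl
  verts-mapWalk (step e p) = cong (_ ∷_) (verts-mapWalk p)

suffixWalk : ∀ {V : Set} {E : V → V → Bool} {u v w} (p : Walk E u v) → w ∈ verts p →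
             Σ (Walk E w v) λ q → ∃ λ pre → verts p ≡ pre ++ verts q
suffixWalk (here u)   (here refl) = here u , [] , refl
suffixWalk (step e p) (here refl) = step e p , [] , refl
suffixWalk (step {u = u} e p) (there w∈p) with suffixWalk p w∈p
... | q , pre , p≡pre++q = q , u ∷ pre , cong (u ∷_) p≡pre++q

verts-head-injective : ∀ {V : Set} {E : V → V → Bool} {u w v} (p : Walk E u v) (q : Walk E w v) →
                       verts p ≡ verts q → u ≡ w
verts-head-injective (here _)   (here _)   eq = ∷-injectiveˡ eq
verts-head-injective (here _)   (step _ _) eq = ∷-injectiveˡ eq
verts-head-injective (step _ _) (here _)   eq = ∷-injectiveˡ eq
verts-head-injective (step _ _) (step _ _) eq = ∷-injectiveˡ eq

module Chains {V : Set} (E : V → V → Bool) where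

  Chain : V → List V → Set
  Chain u []       = ⊤
  Chain u (w ∷ ws) = E u w ≡ true × Chain w ws

  end : V → List V → V
  end u []       = u
  end u (w ∷ ws) = end w ws

  walk : ∀ u ws → Chain u ws → Walk E u (end u ws)
  walk u []       _       = here u
  walk u (w ∷ ws) (e , c) = step e (walk w ws c)

  verts-walk : ∀ u ws (c : Chain u ws) → verts (walk u ws c) ≡ u ∷ ws
  verts-walk u []       _       = refl
  verts-walk u (w ∷ ws) (e , c) = cong (u ∷_) (verts-walk w ws c)

  chainPath : ∀ {u v} ws → Chain u ws → Unique (u ∷ ws) → end u ws ≡ v → Path E u v
  chainPath {u} ws c u∷ws! refl = walk u ws c , subst Unique (sym (verts-walk u ws c)) u∷ws!

  verts-chainPath : ∀ {u v} ws (c : Chain u ws) (u∷ws! : Unique (u ∷ ws)) (e : end u ws ≡ v) →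
                    verts (proj₁ (chainPath ws c u∷ws! e)) ≡ u ∷ ws
  verts-chainPath {u} ws c _ refl = verts-walk u ws c

  Chain-snoc : ∀ u ws {v} → Chain u ws → E (end u ws) v ≡ true → Chain u (ws ++ [ v ])
  Chain-snoc u []       _        e = e , tt
  Chain-snoc u (w ∷ ws) (e′ , c) e = e′ , Chain-snoc w ws c e

  end-snoc : ∀ u ws v → end u (ws ++ [ v ]) ≡ v
  end-snoc u []       v = refl
  end-snoc u (w ∷ ws) v = end-snoc w ws v

  module Routing (route : V → V → List V)
                 (route-self : ∀ v → route v v ≡ [])
                 (route-step : ∀ {u w} v → E u w ≡ true → u ∉ w ∷ route w v → route u v ≡ w ∷ route w v)
                 where

    simple-walk≡route : ∀ {u v} (p : Walk E u v) → Unique (verts p) → verts p ≡ u ∷ route u v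
    simple-walk≡route (here u) _ = cong (u ∷_) (sym (route-self u))
    simple-walk≡route {u} {v} (step {w = w} e p) (u∉p ∷ p!) =
      cong (u ∷_) (trans p≡route (sym (route-step v e (All¬⇒¬Any u∉p ∘ subst (u ∈_) (sym p≡route)))))
      where
      p≡route : verts p ≡ w ∷ route w v
      p≡route = simple-walk≡route p p!

    path-unique : ∀ u v (p q : Path E u v) → verts (proj₁ p) ≡ verts (proj₁ q)
    path-unique u v (p , p!) (q , q!) = trans (simple-walk≡route p p!) (sym (simple-walk≡route q q!))

-- Caterpillars

isSucc : Fin 3 → Fin 3 → Bool
isSucc zero       (suc zero)       = true
isSucc (suc zero) (suc (suc zero)) = true
isSucc _          _                = false

spineAdj : Fin 3 → Fin 3 → Bool
spineAdj k k′ = isSucc k k′ ∨ isSucc k′ k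

spineRoute : Fin 3 → Fin 3 → List (Fin 3)
spineRoute zero             zero             = []
spineRoute zero             (suc zero)       = suc zero ∷ []
spineRoute zero             (suc (suc zero)) = suc zero ∷ suc (suc zero) ∷ []
spineRoute (suc zero)       zero             = zero ∷ []
spineRoute (suc zero)       (suc zero)       = []
spineRoute (suc zero)       (suc (suc zero)) = suc (suc zero) ∷ []
spineRoute (suc (suc zero)) zero             = suc zero ∷ zero ∷ []
spineRoute (suc (suc zero)) (suc zero)       = suc zero ∷ []
spineRoute (suc (suc zero)) (suc (suc zero)) = []

spineRoute-self : ∀ k → spineRoute k k ≡ []
spineRoute-self zero             = refl
spineRoute-self (suc zero)       = refl
spineRoute-self (suc (suc zero)) = refl

module Spine = Chains spineAdj

spineRoute-simple : ∀ k k′ → Spine.Chain k (spineRoute k k′) × Unique (k ∷ spineRoute k k′) ×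
                              Spine.end k (spineRoute k k′) ≡ k′
spineRoute-simple zero             zero             = tt , [] ∷ [] , refl
spineRoute-simple zero             (suc zero)       = (refl , tt) , ((λ ()) ∷ []) ∷ [] ∷ [] , refl
spineRoute-simple zero             (suc (suc zero)) =
  (refl , refl , tt) , ((λ ()) ∷ (λ ()) ∷ []) ∷ ((λ ()) ∷ []) ∷ [] ∷ [] , refl
spineRoute-simple (suc zero)       zero             = (refl , tt) , ((λ ()) ∷ []) ∷ [] ∷ [] , refl
spineRoute-simple (suc zero)       (suc zero)       = tt , [] ∷ [] , refl
spineRoute-simple (suc zero)       (suc (suc zero)) = (refl , tt) , ((λ ()) ∷ []) ∷ [] ∷ [] , refl
spineRoute-simple (suc (suc zero)) zero             =
  (refl , refl , tt) , ((λ ()) ∷ (λ ()) ∷ []) ∷ ((λ ()) ∷ []) ∷ [] ∷ [] , refl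
spineRoute-simple (suc (suc zero)) (suc zero)       = (refl , tt) , ((λ ()) ∷ []) ∷ [] ∷ [] , refl
spineRoute-simple (suc (suc zero)) (suc (suc zero)) = tt , [] ∷ [] , refl

spineRoute-step : ∀ k k′ k″ → spineAdj k k′ ≡ true → k ∉ k′ ∷ spineRoute k′ k″ →
                  spineRoute k k″ ≡ k′ ∷ spineRoute k′ k″
spineRoute-step zero             (suc zero)       zero             _ k∉ = ⊥-elim (k∉ (there (here refl)))
spineRoute-step zero             (suc zero)       (suc zero)       _ _  = refl
spineRoute-step zero             (suc zero)       (suc (suc zero)) _ _  = refl
spineRoute-step (suc zero)       zero             zero             _ _  = refl
spineRoute-step (suc zero)       zero             (suc zero)       _ k∉ = ⊥-elim (k∉ (there (here refl)))
spineRoute-step (suc zero)       zero             (suc (suc zero)) _ k∉ = ⊥-elim (k∉ (there (here refl)))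
spineRoute-step (suc zero)       (suc (suc zero)) zero             _ k∉ = ⊥-elim (k∉ (there (here refl)))
spineRoute-step (suc zero)       (suc (suc zero)) (suc zero)       _ k∉ = ⊥-elim (k∉ (there (here refl)))
spineRoute-step (suc zero)       (suc (suc zero)) (suc (suc zero)) _ _  = refl
spineRoute-step (suc (suc zero)) (suc zero)       zero             _ _  = refl
spineRoute-step (suc (suc zero)) (suc zero)       (suc zero)       _ _  = refl
spineRoute-step (suc (suc zero)) (suc zero)       (suc (suc zero)) _ k∉ = ⊥-elim (k∉ (there (here refl)))
spineRoute-step zero             zero             _ ()
spineRoute-step zero             (suc (suc zero)) _ ()
spineRoute-step (suc zero)       (suc zero)       _ ()
spineRoute-step (suc (suc zero)) zero             _ ()
spineRoute-step (suc (suc zero)) (suc (suc zero)) _ ()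

-- the caterpillar with spine 0 — 1 — 2 and leaf i attached to spine node pos i
attachedTo : Fin 3 → Vtx 5 3 → Bool
attachedTo k (inj₁ _)  = false
attachedTo k (inj₂ k′) = does (k Finₚ.≟ k′)

caterpillarAdj : (Fin 5 → Fin 3) → Vtx 5 3 → Vtx 5 3 → Bool
caterpillarAdj pos (inj₁ i) v         = attachedTo (pos i) v
caterpillarAdj pos (inj₂ k) (inj₁ j)  = attachedTo (pos j) (inj₂ k)
caterpillarAdj pos (inj₂ k) (inj₂ k′) = spineAdj k k′

module Caterpillar (pos : Fin 5 → Fin 3) where

  open Chains (caterpillarAdj pos)

  spine-chain : ∀ k ks → Spine.Chain k ks → Chain (inj₂ k) (map inj₂ ks)
  spine-chain k []        _       = tt
  spine-chain k (k′ ∷ ks) (e , c) = e , spine-chain k′ ks c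

  spine-end : ∀ k ks → end (inj₂ k) (map inj₂ ks) ≡ inj₂ (Spine.end k ks)
  spine-end k []        = refl
  spine-end k (k′ ∷ ks) = spine-end k′ ks

  routeFrom : Fin 3 → Vtx 5 3 → List (Vtx 5 3)
  routeFrom k (inj₂ k′) = map inj₂ (spineRoute k k′)
  routeFrom k (inj₁ j)  = map inj₂ (spineRoute k (pos j)) ++ [ inj₁ j ]

  route : Vtx 5 3 → Vtx 5 3 → List (Vtx 5 3)
  route (inj₂ k) v = routeFrom k v
  route (inj₁ i) v = if does (inj₁ i ≟ᵥ v) then [] else inj₂ (pos i) ∷ routeFrom (pos i) v

  routeFrom-end : ∀ k v → end (inj₂ k) (routeFrom k v) ≡ v
  routeFrom-end k (inj₂ k′) =
    trans (spine-end k (spineRoute k k′)) (cong inj₂ (proj₂ (proj₂ (spineRoute-simple k k′))))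
  routeFrom-end k (inj₁ j)  = end-snoc (inj₂ k) (map inj₂ (spineRoute k (pos j))) (inj₁ j)

  routeFrom-chain : ∀ k v → Chain (inj₂ k) (routeFrom k v)
  routeFrom-chain k (inj₂ k′) = spine-chain k _ (proj₁ (spineRoute-simple k k′))
  routeFrom-chain k (inj₁ j)  =
    Chain-snoc (inj₂ k) _ (spine-chain k _ (proj₁ (spineRoute-simple k (pos j))))
      (subst (λ x → caterpillarAdj pos x (inj₁ j) ≡ true) (sym (routeFrom-end k (inj₂ (pos j))))
             (dec-true (pos j Finₚ.≟ pos j) refl))

  routeFrom-unique : ∀ k v → Unique (inj₂ k ∷ routeFrom k v)
  routeFrom-unique k (inj₂ k′) = Uniqueₚ.map⁺ inj₂-injective (proj₁ (proj₂ (spineRoute-simple k k′)))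
  routeFrom-unique k (inj₁ j)  =
    Uniqueₚ.++⁺ (Uniqueₚ.map⁺ inj₂-injective (proj₁ (proj₂ (spineRoute-simple k (pos j))))) ([] ∷ [])
                (λ { (j∈spine , here refl) → leaf∉spine j∈spine })
    where
    leaf∉spine : ∀ {ks} → inj₁ j ∉ map inj₂ ks
    leaf∉spine j∈ with ∈-map⁻ inj₂ j∈
    ... | _ , _ , ()

  leaf∉routeFrom : ∀ i k v → inj₁ i ≢ v → inj₁ i ∉ routeFrom k v
  leaf∉routeFrom i k (inj₂ k′) _ i∈ with ∈-map⁻ inj₂ i∈
  ... | _ , _ , ()
  leaf∉routeFrom i k (inj₁ j) i≢j i∈ with ∈-++⁻ (map inj₂ (spineRoute k (pos j))) i∈
  ... | inj₁ i∈spine with ∈-map⁻ inj₂ i∈spine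
  ...   | _ , _ , ()
  leaf∉routeFrom i k (inj₁ j) i≢j i∈ | inj₂ (here i≡j) = i≢j i≡j

  route-end : ∀ u v → end u (route u v) ≡ v
  route-end (inj₂ k) v = routeFrom-end k v
  route-end (inj₁ i) v with inj₁ i ≟ᵥ v
  ... | yes i≡v = i≡v
  ... | no _    = routeFrom-end (pos i) v

  route-chain : ∀ u v → Chain u (route u v)
  route-chain (inj₂ k) v = routeFrom-chain k v
  route-chain (inj₁ i) v with inj₁ i ≟ᵥ v
  ... | yes _ = tt
  ... | no _  = dec-true (pos i Finₚ.≟ pos i) refl , routeFrom-chain (pos i) v

  route-unique : ∀ u v → Unique (u ∷ route u v)
  route-unique (inj₂ k) v = routeFrom-unique k v
  route-unique (inj₁ i) v with inj₁ i ≟ᵥ v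
  ... | yes _ = [] ∷ []
  ... | no i≢v = ¬Any⇒All¬ _ i∉ ∷ routeFrom-unique (pos i) v
    where
    i∉ : inj₁ i ∉ inj₂ (pos i) ∷ routeFrom (pos i) v
    i∉ (there i∈) = leaf∉routeFrom i (pos i) v i≢v i∈

  route-self : ∀ v → route v v ≡ []
  route-self (inj₂ k) = cong (map inj₂) (spineRoute-self k)
  route-self (inj₁ i) with i Finₚ.≟ i
  ... | yes _ = refl
  ... | no i≢i = ⊥-elim (i≢i refl)

  route-step : ∀ {u w} v → caterpillarAdj pos u w ≡ true → u ∉ w ∷ route w v → route u v ≡ w ∷ route w v
  route-step {inj₁ i} {inj₂ k} v e u∉ with dec-true⁻¹ (pos i Finₚ.≟ k) e
  ... | refl with inj₁ i ≟ᵥ v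
  ...   | yes refl = ⊥-elim (u∉ (there (∈-++⁺ʳ (map inj₂ (spineRoute (pos i) (pos i))) (here refl))))
  ...   | no _     = refl
  route-step {inj₂ k} {inj₁ j} v e u∉ with dec-true⁻¹ (pos j Finₚ.≟ k) e
  ... | refl with inj₁ j ≟ᵥ v
  ...   | yes refl = cong (λ ks → map inj₂ ks ++ [ inj₁ j ]) (spineRoute-self (pos j))
  ...   | no _     = ⊥-elim (u∉ (there (here refl)))
  route-step {inj₂ k} {inj₂ k′} (inj₂ k″) e u∉ =
    cong (map inj₂) (spineRoute-step k k′ k″ e (u∉ ∘ ∈-map⁺ inj₂))
  route-step {inj₂ k} {inj₂ k′} (inj₁ j) e u∉ =
    cong (λ ks → map inj₂ ks ++ [ inj₁ j ]) (spineRoute-step k k′ (pos j) e (u∉ ∘ ∈-++⁺ˡ ∘ ∈-map⁺ inj₂))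

  routePath : ∀ u v → Path (caterpillarAdj pos) u v
  routePath u v = chainPath (route u v) (route-chain u v) (route-unique u v) (route-end u v)

  verts-routePath : ∀ u v → verts (proj₁ (routePath u v)) ≡ u ∷ route u v
  verts-routePath u v = verts-chainPath (route u v) (route-chain u v) (route-unique u v) (route-end u v)

  catℓ : Fin 5 → Fin 5 → ℕ
  catℓ i j = internals (inj₁ i ∷ route (inj₁ i) (inj₁ j))

  adj-symmetric : ∀ u v → caterpillarAdj pos u v ≡ caterpillarAdj pos v u
  adj-symmetric (inj₁ i) (inj₁ j)  = refl
  adj-symmetric (inj₁ i) (inj₂ k)  = refl
  adj-symmetric (inj₂ k) (inj₁ j)  = refl
  adj-symmetric (inj₂ k) (inj₂ k′) = ∨-comm (isSucc k k′) (isSucc k′ k)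

  adj-irreflexive : ∀ u → caterpillarAdj pos u u ≡ false
  adj-irreflexive (inj₁ i)                = refl
  adj-irreflexive (inj₂ zero)             = refl
  adj-irreflexive (inj₂ (suc zero))       = refl
  adj-irreflexive (inj₂ (suc (suc zero))) = refl

  leaf-degree : ∀ i → degree (caterpillarAdj pos) (inj₁ i) ≡ 1
  leaf-degree i = attached-once (pos i)
    where
    attached-once : ∀ k → length (filterᵇ (attachedTo k) (allVtx 5 3)) ≡ 1
    attached-once zero             = refl
    attached-once (suc zero)       = refl
    attached-once (suc (suc zero)) = refl

  caterpillar : (∀ k → degree (caterpillarAdj pos) (inj₂ k) ≡ 3) → BinTree 5
  caterpillar internal-degree = record
    { m = 3 ; adj = caterpillarAdj pos ; adj-sym = adj-symmetric ; adj-irr = adj-irreflexive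
    ; leaf-deg = leaf-degree ; int-deg = internal-degree
    ; path = routePath ; path-uniq = Routing.path-unique route route-self route-step }

  ℓ-caterpillar : ∀ deg i j → ℓ (caterpillar deg) i j ≡ catℓ i j
  ℓ-caterpillar deg i j = cong internals (verts-routePath (inj₁ i) (inj₁ j))

module Tree {n : ℕ} (t : BinTree n) where

  private
    V : Set
    V = Vtx n (m t)

    E : V → V → Bool
    E = adj t

  E-sym : ∀ {u v} → E u v ≡ true → E v u ≡ true
  E-sym {u} {v} e = trans (adj-sym t v u) e

  E-irr : ∀ {u v} → E u v ≡ true → u ≢ v
  E-irr {u} e refl = case trans (sym e) (adj-irr t u) of λ ()

  neighbours : V → List V
  neighbours v = filterᵇ (E v) (allVtx n (m t))

  ∈-neighbours⁺ : ∀ {v w} → E v w ≡ true → w ∈ neighbours v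
  ∈-neighbours⁺ {v} {w} e = ∈-filter⁺ (T? ∘ E v) (∈-allVtx w) (Equivalence.from T-≡ e)

  ∈-neighbours⁻ : ∀ {v w} → w ∈ neighbours v → E v w ≡ true
  ∈-neighbours⁻ {v} w∈ = Equivalence.to T-≡ (proj₂ (∈-filter⁻ (T? ∘ E v) {xs = allVtx n (m t)} w∈))

  neighbours-unique : ∀ v → Unique (neighbours v)
  neighbours-unique v = Uniqueₚ.filter⁺ (T? ∘ E v) allVtx-unique

  leaf-neighbours : ∀ i → length (neighbours (inj₁ i)) ≡ 1
  leaf-neighbours = leaf-deg t

  node-neighbours : ∀ k → length (neighbours (inj₂ k)) ≡ 3
  node-neighbours = int-deg t

  leaf-neighbour-unique : ∀ {i v w} → E (inj₁ i) v ≡ true → E (inj₁ i) w ≡ true → v ≡ w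
  leaf-neighbour-unique {i} ev ew
    with neighbours (inj₁ i) | leaf-neighbours i | ∈-neighbours⁺ ev | ∈-neighbours⁺ ew
  ... | _ ∷ [] | _ | here refl | here refl = refl

  record OtherNeighbours (k : Fin (m t)) (p : V) : Set where
    field
      y z    : V
      edge-y : E (inj₂ k) y ≡ true
      edge-z : E (inj₂ k) z ≡ true
      y≢p    : y ≢ p
      z≢p    : z ≢ p
      y≢z    : y ≢ z
      cover  : ∀ {x} → E (inj₂ k) x ≡ true → x ≡ p ⊎ x ≡ y ⊎ x ≡ z

  otherNeighbours : ∀ {k p} → E (inj₂ k) p ≡ true → OtherNeighbours k p
  otherNeighbours {k} e
    with neighbours (inj₂ k) | node-neighbours k | neighbours-unique (inj₂ k)
       | ∈-neighbours⁺ {inj₂ k} | ∈-neighbours⁻ {inj₂ k}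
  ... | x ∷ y ∷ z ∷ [] | _ | (x≢y ∷ x≢z ∷ []) ∷ (y≢z ∷ []) ∷ _ | ∈⁺ | ∈⁻ with ∈⁺ e
  ... | here refl = record
    { y = y ; z = z ; edge-y = ∈⁻ (there (here refl)) ; edge-z = ∈⁻ (there (there (here refl)))
    ; y≢p = x≢y ∘ sym ; z≢p = x≢z ∘ sym ; y≢z = y≢z
    ; cover = λ e′ → case ∈⁺ e′ of λ
        { (here eq) → inj₁ eq ; (there (here eq)) → inj₂ (inj₁ eq) ; (there (there (here eq))) → inj₂ (inj₂ eq) } }
  ... | there (here refl) = record
    { y = x ; z = z ; edge-y = ∈⁻ (here refl) ; edge-z = ∈⁻ (there (there (here refl)))
    ; y≢p = x≢y ; z≢p = y≢z ∘ sym ; y≢z = x≢z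
    ; cover = λ e′ → case ∈⁺ e′ of λ
        { (here eq) → inj₂ (inj₁ eq) ; (there (here eq)) → inj₁ eq ; (there (there (here eq))) → inj₂ (inj₂ eq) } }
  ... | there (there (here refl)) = record
    { y = x ; z = y ; edge-y = ∈⁻ (here refl) ; edge-z = ∈⁻ (there (here refl))
    ; y≢p = x≢z ; z≢p = y≢z ; y≢z = x≢y
    ; cover = λ e′ → case ∈⁺ e′ of λ
        { (here eq) → inj₂ (inj₁ eq) ; (there (here eq)) → inj₂ (inj₂ eq) ; (there (there (here eq))) → inj₁ eq } }

  record ThirdNeighbour (k : Fin (m t)) (p q : V) : Set where
    field
      r      : V
      edge-r : E (inj₂ k) r ≡ true
      r≢p    : r ≢ p
      r≢q    : r ≢ q
      cover  : ∀ {x} → E (inj₂ k) x ≡ true → x ≡ p ⊎ x ≡ q ⊎ x ≡ r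

  thirdNeighbour : ∀ {k p q} → E (inj₂ k) p ≡ true → E (inj₂ k) q ≡ true → q ≢ p → ThirdNeighbour k p q
  thirdNeighbour e-p e-q q≢p with otherNeighbours e-p
  ... | o with OtherNeighbours.cover o e-q
  ...   | inj₁ q≡p        = contradiction q≡p q≢p
  ...   | inj₂ (inj₁ refl) = record
    { r = z ; edge-r = edge-z ; r≢p = z≢p ; r≢q = y≢z ∘ sym ; cover = cover }
    where open OtherNeighbours o
  ...   | inj₂ (inj₂ refl) = record
    { r = y ; edge-r = edge-y ; r≢p = y≢p ; r≢q = y≢z ; cover = Sum.map₂ Sum.swap ∘ cover }
    where open OtherNeighbours o

  path-unique : ∀ {u v} (p q : Walk E u v) → Unique (verts p) → Unique (verts q) → verts p ≡ verts q
  path-unique p q p! q! = path-uniq t _ _ (p , p!) (q , q!)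

  -- the suffix of p from w, preceded by the edge v — w, is a second simple walk from v to s
  no-shortcut : ∀ {v u w s} (e : E v u ≡ true) (p : Walk E u s) → Unique (verts (step e p)) →
                E v w ≡ true → w ∈ verts p → w ≡ u
  no-shortcut {v} e p (v∉p ∷ p!) e-vw w∈p with suffixWalk p w∈p
  ... | q , pre , p≡pre++q = verts-head-injective q p q≡p
    where
    q! : Unique (verts q)
    q! = Unique-suffix pre (subst Unique p≡pre++q p!)
    v∉q : All (v ≢_) (verts q)
    v∉q = ++⁻ʳ pre (subst (All (v ≢_)) p≡pre++q v∉p)
    q≡p : verts q ≡ verts p
    q≡p = ∷-injectiveʳ (path-unique (step e-vw q) (step e p) (v∉q ∷ q!) (v∉p ∷ p!))

  extend : ∀ {v u w s} (e : E v u ≡ true) (p : Walk E u s) → Unique (verts (step e p)) →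
           (e-vw : E v w ≡ true) → w ≢ u → Unique (verts (step (E-sym e-vw) (step e p)))
  extend e p p! e-vw w≢u = ¬Any⇒All¬ _ w∉ ∷ p!
    where
    w∉ : _ ∉ verts (step e p)
    w∉ (here refl)  = E-irr e-vw refl
    w∉ (there w∈p) = w≢u (no-shortcut e p p! e-vw w∈p)

  -- Walks are explored backwards: a walk from the current vertex to the start s is
  -- extended by prepending a step.  A LeafBeyond s P is such a walk from a leaf
  -- extending the walk with vertex list P.
  record LeafBeyond (s : V) (P : List V) : Set where
    constructor leafBeyond
    field
      leaf    : Fin n
      walk    : Walk E (inj₁ leaf) s
      simple  : Unique (verts walk)
      ext     : List V
      through : verts walk ≡ ext ++ P

  open LeafBeyond public

  shorten : ∀ {s P} xs → LeafBeyond s (xs ++ P) → LeafBeyond s P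
  shorten {P = P} xs (leafBeyond ℓ w w! ext w≡) =
    leafBeyond ℓ w w! (ext ++ xs) (trans w≡ (sym (++-assoc ext xs P)))

  distinct-leaves : ∀ {s P Q} (L : LeafBeyond s P) (L′ : LeafBeyond s Q) →
                    length P ≡ length Q → P ≢ Q → leaf L ≢ leaf L′
  distinct-leaves (leafBeyond _ w w! ext w≡) (leafBeyond _ w′ w′! ext′ w′≡) |P|≡|Q| P≢Q refl =
    P≢Q (++-suffix-≡ |P|≡|Q| (trans (sym w≡) (trans (path-unique w w′ w! w′!) w′≡)))

  branch-distinct : ∀ {s x y Q} (L : LeafBeyond s (x ∷ Q)) (L′ : LeafBeyond s (y ∷ Q)) → x ≢ y → leaf L ≢ leaf L′
  branch-distinct L L′ x≢y = distinct-leaves L L′ refl (x≢y ∘ ∷-injectiveˡ)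

  leaf≢start : ∀ {a v u P} (L : LeafBeyond (inj₁ a) (v ∷ u ∷ P)) → leaf L ≢ a
  leaf≢start (leafBeyond _ w w! ext w≡) refl = [x]≢ ext (trans (path-unique (here _) w ([] ∷ []) w!) w≡)
    where
    [x]≢ : ∀ ext {x v u P} → x ∷ [] ≢ ext ++ v ∷ u ∷ P
    [x]≢ []          ()
    [x]≢ (_ ∷ [])    ()
    [x]≢ (_ ∷ _ ∷ _) ()

  private
    #V : ℕ
    #V = length (allVtx n (m t))

  reachLeaf′ : ∀ fuel {v u s} (e : E v u ≡ true) (p : Walk E u s) → Unique (verts (step e p)) →
               #V ℕ.< length (verts (step e p)) ℕ.+ fuel → LeafBeyond s (verts (step e p))
  reachLeaf′ _ {inj₁ ℓ} e p p! _ = leafBeyond ℓ (step e p) p! [] refl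
  reachLeaf′ zero {inj₂ k} e p p! #V< =
    ⊥-elim (ℕₚ.<-irrefl refl (ℕₚ.<-≤-trans #V< (subst (ℕ._≤ #V) (sym (ℕₚ.+-identityʳ _))
                                        (Unique⇒length≤ _≟ᵥ_ p! (λ {v} _ → ∈-allVtx v)))))

  reachLeaf′ (suc fuel) {inj₂ k} e p p! #V< =
    shorten [ y ] (reachLeaf′ fuel (E-sym edge-y) (step e p) (extend e p p! edge-y y≢p)
                        (subst (#V ℕ.<_) (ℕₚ.+-suc (length (verts (step e p))) fuel) #V<))
    where open OtherNeighbours (otherNeighbours e)

  reachLeaf : ∀ {v u s} (e : E v u ≡ true) (p : Walk E u s) → Unique (verts (step e p)) →
              LeafBeyond s (verts (step e p))
  reachLeaf e p p! = reachLeaf′ #V e p p! (ℕₚ.m<n+m #V z<s)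

  record TwoLeavesBeyond (s : V) (P : List V) : Set where
    field
      first second : LeafBeyond s P
      distinct     : leaf first ≢ leaf second

  twoLeaves : ∀ {k u s} (e : E (inj₂ k) u ≡ true) (p : Walk E u s) → Unique (verts (step e p)) →
              TwoLeavesBeyond s (verts (step e p))
  twoLeaves {s = s} e p p! = record
    { first = shorten [ y ] L ; second = shorten [ z ] L′ ; distinct = branch-distinct L L′ y≢z }
    where
    open OtherNeighbours (otherNeighbours e)
    L : LeafBeyond s (y ∷ verts (step e p))
    L = reachLeaf (E-sym edge-y) (step e p) (extend e p p! edge-y y≢p)
    L′ : LeafBeyond s (z ∷ verts (step e p))
    L′ = reachLeaf (E-sym edge-z) (step e p) (extend e p p! edge-z z≢p)

  Within : List (Fin n) → List (Fin (m t)) → V → Set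
  Within leaves nodes (inj₁ i) = i ∈ leaves
  Within leaves nodes (inj₂ k) = k ∈ nodes

  closed⇒covers : ∀ {leaves nodes} → (∀ {x y} → Within leaves nodes x → E x y ≡ true → Within leaves nodes y) →
                  ∀ {x} → Within leaves nodes x → n ℕ.≤ length leaves
  closed⇒covers {leaves} {nodes} closed {x} x∈ =
    covering⇒length≥n leaves (λ i → along (proj₁ (path t x (inj₁ i))) x∈)
    where
    along : ∀ {u v} → Walk E u v → Within leaves nodes u → Within leaves nodes v
    along (here _)   u∈ = u∈
    along (step e p) u∈ = along p (closed u∈ e)

  leaves-at-distinct-nodes : ∀ {i j k k′} → E (inj₁ i) (inj₂ k) ≡ true → E (inj₁ j) (inj₂ k′) ≡ true →
                             k ≢ k′ → i ≢ j
  leaves-at-distinct-nodes i-k j-k′ k≢k′ refl = k≢k′ (inj₂-injective (leaf-neighbour-unique i-k j-k′))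

  -- the image of a simple path is a simple path, and paths in a tree are unique
  module _ {m′} (E′ : Vtx n m′ → Vtx n m′ → Bool) (node : Fin m′ → Fin (m t))
           (node-injective : ∀ {k k′} → node k ≡ node k′ → k ≡ k′)
           (preserves-edges : ∀ {u v} → E′ u v ≡ true → E (Sum.map₂ node u) (Sum.map₂ node v) ≡ true) where

    ℓ-via-embedding : ∀ {i j} (p : Path E′ (inj₁ i) (inj₁ j)) → ℓ t i j ≡ internals (verts (proj₁ p))
    ℓ-via-embedding {i} {j} (p , p!) = begin
      ℓ t i j                     ≡⟨ cong internals (path-uniq t _ _ (path t (inj₁ i) (inj₁ j)) (φp , φp!)) ⟩
      internals (verts φp)        ≡⟨ cong internals (verts-mapWalk φ preserves-edges p) ⟩
      internals (map φ (verts p)) ≡⟨ internals-map₂ node (verts p) ⟩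
      internals (verts p)         ∎
      where
      open ≡-Reasoning
      φ : Vtx n m′ → Vtx n (m t)
      φ = Sum.map₂ node
      φ-injective : ∀ {u v} → φ u ≡ φ v → u ≡ v
      φ-injective {inj₁ _} {inj₁ _} eq = cong inj₁ (inj₁-injective eq)
      φ-injective {inj₂ _} {inj₂ _} eq = cong inj₂ (node-injective (inj₂-injective eq))
      φp : Walk E (inj₁ i) (inj₁ j)
      φp = mapWalk φ preserves-edges p
      φp! : Unique (verts φp)
      φp! = subst Unique (sym (verts-mapWalk φ preserves-edges p)) (Uniqueₚ.map⁺ φ-injective p!)

-- Trees with a cherry are caterpillars

position : Bool → Bool → Fin 3
position true  _     = zero
position false true  = suc zero
position false false = suc (suc zero)

-- the caterpillar with cherry {a,b} at spine node 0, middle leaf y, and the two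
-- remaining leaves forming the second cherry
cherryPos : Fin 5 → Fin 5 → Fin 5 → Fin 5 → Fin 3
cherryPos a b y i = position (does (i Finₚ.≟ a) ∨ does (i Finₚ.≟ b)) (does (i Finₚ.≟ y))

no-six-distinct : ∀ {x₁ x₂ x₃ x₄ x₅ x₆ : Fin 5} → ¬ Unique (x₁ ∷ x₂ ∷ x₃ ∷ x₄ ∷ x₅ ∷ x₆ ∷ [])
no-six-distinct xs! = case Unique⇒length≤n xs! of λ { (s≤s (s≤s (s≤s (s≤s (s≤s ()))))) }

module Classification (t : BinTree 5) where

  open Tree t

  private
    V : Set
    V = Vtx 5 (m t)

    E : V → V → Bool
    E = adj t

  record CaterpillarShape (a b : Fin 5) : Set where
    field
      y p q : Fin 5
      U W Y : Fin (m t)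
      a-U   : E (inj₁ a) (inj₂ U) ≡ true
      b-U   : E (inj₁ b) (inj₂ U) ≡ true
      y-W   : E (inj₁ y) (inj₂ W) ≡ true
      p-Y   : E (inj₁ p) (inj₂ Y) ≡ true
      q-Y   : E (inj₁ q) (inj₂ Y) ≡ true
      U-W   : E (inj₂ U) (inj₂ W) ≡ true
      W-Y   : E (inj₂ W) (inj₂ Y) ≡ true
      U≢Y   : U ≢ Y
      p≢q   : p ≢ q

  module CherryNode {a b u} (a≢b : a ≢ b)
                    (a-U : E (inj₁ a) (inj₂ u) ≡ true) (b-U : E (inj₁ b) (inj₂ u) ≡ true) where

    private
      A B U : V
      A = inj₁ a
      B = inj₁ b
      U = inj₂ u

    toU : Walk E U A
    toU = step (E-sym a-U) (here A)

    toU! : Unique (verts toU)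
    toU! = ((λ ()) ∷ []) ∷ [] ∷ []

    leafB : LeafBeyond A (B ∷ U ∷ A ∷ [])
    leafB = leafBeyond b (step b-U toU) (((λ ()) ∷ (a≢b ∘ sym ∘ inj₁-injective) ∷ []) ∷ toU!) [] refl

    beyond≢b : ∀ {W} → W ≢ B → ∀ xs (L : LeafBeyond A (xs ++ W ∷ U ∷ A ∷ [])) → b ≢ leaf L
    beyond≢b W≢B xs L = ≢-sym (branch-distinct (shorten xs L) leafB W≢B)

    module SecondNode (w : Fin (m t)) (U-W : E U (inj₂ w) ≡ true) (W≢B : inj₂ w ≢ B)
                      (coverU : ∀ {x} → E U x ≡ true → x ≡ A ⊎ x ≡ B ⊎ x ≡ inj₂ w) where

      private
        W : V
        W = inj₂ w

      toW : Walk E W A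
      toW = step (E-sym U-W) toU

      toW! : Unique (verts toW)
      toW! = extend (E-sym a-U) (here A) toU! U-W (λ ())

      module ThirdNode (k : Fin (m t)) (mid : Fin 5) (W-Y : E W (inj₂ k) ≡ true)
                       (W-mid : E W (inj₁ mid) ≡ true) (Y≢U : inj₂ k ≢ U) where

        private
          Y : V
          Y = inj₂ k

        toY : Walk E Y A
        toY = step (E-sym W-Y) toW

        toY! : Unique (verts toY)
        toY! = extend (E-sym U-W) toU toW! W-Y Y≢U

        leafMid : LeafBeyond A (inj₁ mid ∷ W ∷ U ∷ A ∷ [])
        leafMid = leafBeyond mid (step (E-sym W-mid) toW) (extend (E-sym U-W) toU toW! W-mid (λ ())) [] refl

        -- a second internal node beyond Y would give six leaves
        deep : ∀ {k₁ v} → E Y (inj₂ k₁) ≡ true → E Y v ≡ true → inj₂ k₁ ≢ W → v ≢ W → inj₂ k₁ ≢ v → ⊥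
        deep {k₁} {v} Y-k₁ Y-v k₁≢W v≢W k₁≢v = no-six-distinct
          ( (a≢b ∷ ≢-sym (leaf≢start leafMid) ∷ ≢-sym (leaf≢start L₁) ∷ ≢-sym (leaf≢start L₂)
             ∷ ≢-sym (leaf≢start L₃) ∷ [])
          ∷ (beyond≢b W≢B [ inj₁ mid ] leafMid ∷ beyond≢b W≢B (inj₂ k₁ ∷ Y ∷ []) L₁
             ∷ beyond≢b W≢B (inj₂ k₁ ∷ Y ∷ []) L₂ ∷ beyond≢b W≢B (v ∷ Y ∷ []) L₃ ∷ [])
          ∷ (branch-distinct leafMid (shorten [ inj₂ k₁ ] L₁) (λ ())
             ∷ branch-distinct leafMid (shorten [ inj₂ k₁ ] L₂) (λ ())
             ∷ branch-distinct leafMid (shorten [ v ] L₃) (λ ()) ∷ [])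
          ∷ (TwoLeavesBeyond.distinct T₁ ∷ branch-distinct L₁ L₃ k₁≢v ∷ [])
          ∷ (branch-distinct L₂ L₃ k₁≢v ∷ [])
          ∷ [] ∷ [] )
          where
          T₁ : TwoLeavesBeyond A (inj₂ k₁ ∷ verts toY)
          T₁ = twoLeaves (E-sym Y-k₁) toY (extend (E-sym W-Y) toW toY! Y-k₁ k₁≢W)
          L₁ L₂ : LeafBeyond A (inj₂ k₁ ∷ verts toY)
          L₁ = TwoLeavesBeyond.first T₁
          L₂ = TwoLeavesBeyond.second T₁
          L₃ : LeafBeyond A (v ∷ verts toY)
          L₃ = reachLeaf (E-sym Y-v) toY (extend (E-sym W-Y) toW toY! Y-v v≢W)

        open OtherNeighbours (otherNeighbours (E-sym W-Y))

        shape : CaterpillarShape a b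
        shape with y | z | edge-y | edge-z | y≢p | z≢p | y≢z
        ... | inj₂ k₁ | v       | Y-k₁ | Y-v  | k₁≢W | v≢W | k₁≢v = ⊥-elim (deep Y-k₁ Y-v k₁≢W v≢W k₁≢v)
        ... | inj₁ p  | inj₂ k₂ | Y-p  | Y-k₂ | p≢W  | k₂≢W | p≢k₂ = ⊥-elim (deep Y-k₂ Y-p k₂≢W p≢W (p≢k₂ ∘ sym))
        ... | inj₁ p  | inj₁ q  | Y-p  | Y-q  | _    | _    | p≢q = record
          { y = mid ; p = p ; q = q ; U = u ; W = w ; Y = k
          ; a-U = a-U ; b-U = b-U ; y-W = E-sym W-mid ; p-Y = E-sym Y-p ; q-Y = E-sym Y-q
          ; U-W = U-W ; W-Y = W-Y ; U≢Y = Y≢U ∘ cong inj₂ ∘ sym ; p≢q = p≢q ∘ cong inj₁ }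

      open OtherNeighbours (otherNeighbours (E-sym U-W))

      branches : ∀ v v′ → E W v ≡ true → E W v′ ≡ true → v ≢ U → v′ ≢ U → v ≢ v′ →
                 (∀ {x} → E W x ≡ true → x ≡ U ⊎ x ≡ v ⊎ x ≡ v′) → CaterpillarShape a b
      branches (inj₂ k) (inj₁ c) W-k W-c k≢U _ _ _ = ThirdNode.shape k c W-k W-c k≢U
      branches (inj₁ c) (inj₂ k) W-c W-k _ k≢U _ _ = ThirdNode.shape k c W-k W-c k≢U
      branches (inj₂ k) (inj₂ k′) W-k W-k′ k≢U k′≢U k≢k′ _ = ⊥-elim (no-six-distinct
        ( (a≢b ∷ ≢-sym (leaf≢start L₁) ∷ ≢-sym (leaf≢start L₂) ∷ ≢-sym (leaf≢start L₃) ∷ ≢-sym (leaf≢start L₄) ∷ [])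
        ∷ (beyond≢b W≢B [ inj₂ k ] L₁ ∷ beyond≢b W≢B [ inj₂ k ] L₂
           ∷ beyond≢b W≢B [ inj₂ k′ ] L₃ ∷ beyond≢b W≢B [ inj₂ k′ ] L₄ ∷ [])
        ∷ (TwoLeavesBeyond.distinct T₁ ∷ branch-distinct L₁ L₃ k≢k′ ∷ branch-distinct L₁ L₄ k≢k′ ∷ [])
        ∷ (branch-distinct L₂ L₃ k≢k′ ∷ branch-distinct L₂ L₄ k≢k′ ∷ [])
        ∷ (TwoLeavesBeyond.distinct T₂ ∷ [])
        ∷ [] ∷ [] ))
        where
        T₁ : TwoLeavesBeyond A (inj₂ k ∷ verts toW)
        T₁ = twoLeaves (E-sym W-k) toW (extend (E-sym U-W) toU toW! W-k k≢U)
        T₂ : TwoLeavesBeyond A (inj₂ k′ ∷ verts toW)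
        T₂ = twoLeaves (E-sym W-k′) toW (extend (E-sym U-W) toU toW! W-k′ k′≢U)
        L₁ L₂ : LeafBeyond A (inj₂ k ∷ verts toW)
        L₁ = TwoLeavesBeyond.first T₁
        L₂ = TwoLeavesBeyond.second T₁
        L₃ L₄ : LeafBeyond A (inj₂ k′ ∷ verts toW)
        L₃ = TwoLeavesBeyond.first T₂
        L₄ = TwoLeavesBeyond.second T₂
      branches (inj₁ c) (inj₁ c′) W-c W-c′ _ _ _ coverW =
        case closed⇒covers closed {inj₁ a} (here refl) of λ { (s≤s (s≤s (s≤s (s≤s ())))) }
        where
        closed : ∀ {x x′} → Within (a ∷ b ∷ c ∷ c′ ∷ []) (u ∷ w ∷ []) x → E x x′ ≡ true →
                 Within (a ∷ b ∷ c ∷ c′ ∷ []) (u ∷ w ∷ []) x′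
        closed {inj₁ _} (here refl) e rewrite leaf-neighbour-unique e a-U = here refl
        closed {inj₁ _} (there (here refl)) e rewrite leaf-neighbour-unique e b-U = here refl
        closed {inj₁ _} (there (there (here refl))) e rewrite leaf-neighbour-unique e (E-sym W-c) = there (here refl)
        closed {inj₁ _} (there (there (there (here refl)))) e
          rewrite leaf-neighbour-unique e (E-sym W-c′) = there (here refl)
        closed {inj₂ _} (here refl) e with coverU e
        ... | inj₁ refl        = here refl
        ... | inj₂ (inj₁ refl) = there (here refl)
        ... | inj₂ (inj₂ refl) = there (here refl)
        closed {inj₂ _} (there (here refl)) e with coverW e
        ... | inj₁ refl        = here refl
        ... | inj₂ (inj₁ refl) = there (there (here refl))
        ... | inj₂ (inj₂ refl) = there (there (there (here refl)))

      shape : CaterpillarShape a b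
      shape = branches y z edge-y edge-z y≢p z≢p y≢z cover

    third : ThirdNeighbour u A B
    third = thirdNeighbour (E-sym a-U) (E-sym b-U) (a≢b ∘ sym ∘ inj₁-injective)

    open ThirdNeighbour third

    viaThird : ∀ v → E U v ≡ true → v ≢ B → (∀ {x} → E U x ≡ true → x ≡ A ⊎ x ≡ B ⊎ x ≡ v) → CaterpillarShape a b
    viaThird (inj₂ w) U-W W≢B coverU = SecondNode.shape w U-W W≢B coverU
    viaThird (inj₁ c) U-c _   coverU =
      case closed⇒covers closed {inj₁ a} (here refl) of λ { (s≤s (s≤s (s≤s ()))) }
      where
      closed : ∀ {x x′} → Within (a ∷ b ∷ c ∷ []) (u ∷ []) x → E x x′ ≡ true → Within (a ∷ b ∷ c ∷ []) (u ∷ []) x′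
      closed {inj₁ _} (here refl) e rewrite leaf-neighbour-unique e a-U = here refl
      closed {inj₁ _} (there (here refl)) e rewrite leaf-neighbour-unique e b-U = here refl
      closed {inj₁ _} (there (there (here refl))) e rewrite leaf-neighbour-unique e (E-sym U-c) = here refl
      closed {inj₂ _} (here refl) e with coverU e
      ... | inj₁ refl        = here refl
      ... | inj₂ (inj₁ refl) = there (here refl)
      ... | inj₂ (inj₂ refl) = there (there (here refl))

    shape : CaterpillarShape a b
    shape = viaThird r edge-r r≢q cover

  cherry⇒shape : ∀ {a b} → a ≢ b → Cherry t a b → CaterpillarShape a b
  cherry⇒shape a≢b (u , a-U , b-U) = CherryNode.shape a≢b a-U b-U

  module Embed {a b} (a≢b : a ≢ b) (S : CaterpillarShape a b) where

    open CaterpillarShape S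

    private
      U≢W : U ≢ W
      U≢W = E-irr U-W ∘ cong inj₂
      W≢Y : W ≢ Y
      W≢Y = E-irr W-Y ∘ cong inj₂

    node : Fin 3 → Fin (m t)
    node zero             = U
    node (suc zero)       = W
    node (suc (suc zero)) = Y

    node-injective : ∀ {k k′} → node k ≡ node k′ → k ≡ k′
    node-injective {zero}             {zero}             _  = refl
    node-injective {zero}             {suc zero}         eq = ⊥-elim (U≢W eq)
    node-injective {zero}             {suc (suc zero)}   eq = ⊥-elim (U≢Y eq)
    node-injective {suc zero}         {zero}             eq = ⊥-elim (U≢W (sym eq))
    node-injective {suc zero}         {suc zero}         _  = refl
    node-injective {suc zero}         {suc (suc zero)}   eq = ⊥-elim (W≢Y eq)
    node-injective {suc (suc zero)}   {zero}             eq = ⊥-elim (U≢Y (sym eq))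
    node-injective {suc (suc zero)}   {suc zero}         eq = ⊥-elim (W≢Y (sym eq))
    node-injective {suc (suc zero)}   {suc (suc zero)}   _  = refl

    a≢y : a ≢ y
    a≢y = leaves-at-distinct-nodes a-U y-W U≢W

    b≢y : b ≢ y
    b≢y = leaves-at-distinct-nodes b-U y-W U≢W

    leaf-edge : ∀ i → E (inj₁ i) (inj₂ (node (cherryPos a b y i))) ≡ true
    leaf-edge i = attach (i Finₚ.≟ a) (i Finₚ.≟ b) (i Finₚ.≟ y)
      where
      attach : (i≟a : Dec (i ≡ a)) (i≟b : Dec (i ≡ b)) (i≟y : Dec (i ≡ y)) →
               E (inj₁ i) (inj₂ (node (position (does i≟a ∨ does i≟b) (does i≟y)))) ≡ true
      attach (yes refl) _          _          = a-U
      attach (no _)     (yes refl) _          = b-U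
      attach (no _)     (no _)     (yes refl) = y-W
      attach (no i≢a)   (no i≢b)   (no i≢y) with i Finₚ.≟ p | i Finₚ.≟ q
      ... | yes refl | _        = p-Y
      ... | no _     | yes refl = q-Y
      ... | no i≢p   | no i≢q   = ⊥-elim (no-six-distinct
        ( (i≢a ∷ i≢b ∷ i≢y ∷ i≢p ∷ i≢q ∷ [])
        ∷ (a≢b ∷ a≢y ∷ leaves-at-distinct-nodes a-U p-Y U≢Y ∷ leaves-at-distinct-nodes a-U q-Y U≢Y ∷ [])
        ∷ (b≢y ∷ leaves-at-distinct-nodes b-U p-Y U≢Y ∷ leaves-at-distinct-nodes b-U q-Y U≢Y ∷ [])
        ∷ (leaves-at-distinct-nodes y-W p-Y W≢Y ∷ leaves-at-distinct-nodes y-W q-Y W≢Y ∷ [])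
        ∷ (p≢q ∷ [])
        ∷ [] ∷ [] ))

    preserves-edges : ∀ {u v} → caterpillarAdj (cherryPos a b y) u v ≡ true →
                      E (Sum.map₂ node u) (Sum.map₂ node v) ≡ true
    preserves-edges {inj₁ i} {inj₂ k} e with dec-true⁻¹ (cherryPos a b y i Finₚ.≟ k) e
    ... | refl = leaf-edge i
    preserves-edges {inj₂ k} {inj₁ j} e with dec-true⁻¹ (cherryPos a b y j Finₚ.≟ k) e
    ... | refl = E-sym (leaf-edge j)
    preserves-edges {inj₂ zero}             {inj₂ (suc zero)}       _ = U-W
    preserves-edges {inj₂ (suc zero)}       {inj₂ zero}             _ = E-sym U-W
    preserves-edges {inj₂ (suc zero)}       {inj₂ (suc (suc zero))} _ = W-Y
    preserves-edges {inj₂ (suc (suc zero))} {inj₂ (suc zero)}       _ = E-sym W-Y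
    preserves-edges {inj₂ zero}             {inj₂ zero}             ()
    preserves-edges {inj₂ zero}             {inj₂ (suc (suc zero))} ()
    preserves-edges {inj₂ (suc zero)}       {inj₂ (suc zero)}       ()
    preserves-edges {inj₂ (suc (suc zero))} {inj₂ zero}             ()
    preserves-edges {inj₂ (suc (suc zero))} {inj₂ (suc (suc zero))} ()

    ℓ≡catℓ : ∀ i j → ℓ t i j ≡ Caterpillar.catℓ (cherryPos a b y) i j
    ℓ≡catℓ i j =
      trans (ℓ-via-embedding (caterpillarAdj (cherryPos a b y)) node node-injective
                             (λ {u} {v} → preserves-edges {u} {v})
                             (Caterpillar.routePath (cherryPos a b y) (inj₁ i) (inj₁ j)))
            (cong internals (Caterpillar.verts-routePath (cherryPos a b y) (inj₁ i) (inj₁ j)))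

cherry⇒caterpillar : (t : BinTree 5) {a b : Fin 5} → a ≢ b → Cherry t a b →
                     ∃ λ y → y ≢ a × y ≢ b × (∀ i j → ℓ t i j ≡ Caterpillar.catℓ (cherryPos a b y) i j)
cherry⇒caterpillar t a≢b cherry =
  y , ≢-sym a≢y , ≢-sym b≢y , ℓ≡catℓ
  where
  open Classification t
  open CaterpillarShape (cherry⇒shape a≢b cherry) using (y)
  open Embed a≢b (cherry⇒shape a≢b cherry)

∑ : {A : Set} → List A → (A → ℚ) → ℚ
∑ xs f = foldr (λ x s → f x + s) 0ℚ xs

module _ {A : Set} where

  ∑-cong : ∀ xs {f g : A → ℚ} → (∀ {x} → x ∈ xs → f x ≡ g x) → ∑ xs f ≡ ∑ xs g
  ∑-cong []       _   = refl
  ∑-cong (x ∷ xs) f≡g = cong₂ _+_ (f≡g (here refl)) (∑-cong xs (f≡g ∘ there))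

  ∑-0 : ∀ xs → ∑ xs (λ (_ : A) → 0ℚ) ≡ 0ℚ
  ∑-0 []       = refl
  ∑-0 (x ∷ xs) = trans (cong (0ℚ +_) (∑-0 xs)) (ℚₚ.+-identityʳ 0ℚ)

  ∑-+ : ∀ xs (f g : A → ℚ) → ∑ xs (λ x → f x + g x) ≡ ∑ xs f + ∑ xs g
  ∑-+ []       f g = sym (ℚₚ.+-identityʳ 0ℚ)
  ∑-+ (x ∷ xs) f g = trans (cong (f x + g x +_) (∑-+ xs f g)) (interchange (f x) (g x) (∑ xs f) (∑ xs g))

  ∑-*ʳ : ∀ xs (f : A → ℚ) a → ∑ xs f * a ≡ ∑ xs (λ x → f x * a)
  ∑-*ʳ []       f a = ℚₚ.*-zeroˡ a
  ∑-*ʳ (x ∷ xs) f a = trans (ℚₚ.*-distribʳ-+ a (f x) (∑ xs f)) (cong (f x * a +_) (∑-*ʳ xs f a))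

  ∑-*ˡ : ∀ xs (f : A → ℚ) a → a * ∑ xs f ≡ ∑ xs (λ x → a * f x)
  ∑-*ˡ []       f a = ℚₚ.*-zeroʳ a
  ∑-*ˡ (x ∷ xs) f a = trans (ℚₚ.*-distribˡ-+ a (f x) (∑ xs f)) (cong (a * f x +_) (∑-*ˡ xs f a))

  ∑-mono-≤ : ∀ xs {f g : A → ℚ} → (∀ x → f x ≤ g x) → ∑ xs f ≤ ∑ xs g
  ∑-mono-≤ []       _   = ℚₚ.≤-refl
  ∑-mono-≤ (x ∷ xs) f≤g = ℚₚ.+-mono-≤ (f≤g x) (∑-mono-≤ xs f≤g)

  ∑-tight : ∀ xs {f g : A → ℚ} → (∀ x → f x ≤ g x) → ∑ xs f ≡ ∑ xs g → ∀ {x} → x ∈ xs → f x ≡ g x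
  ∑-tight (x ∷ xs) {f} {g} f≤g eq x∈ with ℚₚ.<-cmp (f x) (g x)
  ... | tri< fx<gx _ _ = ⊥-elim (ℚₚ.<-irrefl eq (ℚₚ.+-mono-<-≤ fx<gx (∑-mono-≤ xs f≤g)))
  ... | tri> _ _ gx<fx = ⊥-elim (ℚₚ.<-irrefl refl (ℚₚ.<-≤-trans gx<fx (f≤g x)))
  ∑-tight (x ∷ xs) f≤g eq (here refl) | tri≈ _ fx≡gx _ = fx≡gx
  ∑-tight (x ∷ xs) {f} {g} f≤g eq (there x∈) | tri≈ _ fx≡gx _ =
    ∑-tight xs f≤g (∙-cancelˡ (f x) _ _ (trans eq (cong (_+ ∑ xs g) (sym fx≡gx)))) x∈

∑-swap : ∀ {A B : Set} xs ys (f : A → B → ℚ) → ∑ xs (λ x → ∑ ys (f x)) ≡ ∑ ys (λ y → ∑ xs (λ x → f x y))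
∑-swap []       ys f = sym (∑-0 ys)
∑-swap (x ∷ xs) ys f = trans (cong (∑ ys (f x) +_) (∑-swap xs ys f)) (sym (∑-+ ys (f x) (λ y → ∑ xs (λ x → f x y))))

∑-const : ∀ {A B : Set} (xs : List A) (ys : List B) δ → length xs ≡ length ys → ∑ xs (λ _ → δ) ≡ ∑ ys (λ _ → δ)
∑-const []       []       δ _ = refl
∑-const (x ∷ xs) (y ∷ ys) δ l = cong (δ +_) (∑-const xs ys δ (ℕₚ.suc-injective l))

module _ {K : Set} (cs : List K) where

  dot-congʳ : ∀ c {u v : K → ℚ} → (∀ κ → u κ ≡ v κ) → dot cs c u ≡ dot cs c v
  dot-congʳ c u≗v = ∑-cong cs (λ {κ} _ → cong (c κ *_) (u≗v κ))

  dot-∑ˡ : ∀ {A : Set} xs (h : A → K → ℚ) v → dot cs (λ κ → ∑ xs (λ x → h x κ)) v ≡ ∑ xs (λ x → dot cs (h x) v)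
  dot-∑ˡ xs h v = trans (∑-cong cs (λ {κ} _ → ∑-*ʳ xs (λ x → h x κ) (v κ))) (∑-swap cs xs (λ κ x → h x κ * v κ))

  dot-∑ʳ : ∀ {A : Set} xs c (h : A → K → ℚ) → dot cs c (λ κ → ∑ xs (λ x → h x κ)) ≡ ∑ xs (λ x → dot cs c (h x))
  dot-∑ʳ xs c h = trans (∑-cong cs (λ {κ} _ → ∑-*ˡ xs (λ x → h x κ) (c κ))) (∑-swap cs xs (λ κ x → c κ * h x κ))

  balanced-tight : ∀ {A B : Set} (xs : List A) (ys : List B) (v : A → K → ℚ) (w : B → K → ℚ) →
                   length xs ≡ length ys → (∀ κ → ∑ xs (λ x → v x κ) ≡ ∑ ys (λ y → w y κ)) →
                   ∀ c δ → (∀ x → dot cs c (v x) ≤ δ) → (∀ y → dot cs c (w y) ≡ δ) →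
                   ∀ {x} → x ∈ xs → dot cs c (v x) ≡ δ
  balanced-tight xs ys v w |xs|≡|ys| ∑v≡∑w c δ valid tight =
    ∑-tight xs valid (begin
      ∑ xs (λ x → dot cs c (v x))         ≡⟨ sym (dot-∑ʳ xs c v) ⟩
      dot cs c (λ κ → ∑ xs (λ x → v x κ)) ≡⟨ dot-congʳ c ∑v≡∑w ⟩
      dot cs c (λ κ → ∑ ys (λ y → w y κ)) ≡⟨ dot-∑ʳ ys c w ⟩
      ∑ ys (λ y → dot cs c (w y))         ≡⟨ ∑-cong ys (λ {y} _ → tight y) ⟩
      ∑ ys (λ _ → δ)                      ≡⟨ ∑-const ys xs δ (sym |xs|≡|ys|) ⟩
      ∑ xs (λ _ → δ)                      ∎)
    where open ≡-Reasoning

-- Polytopes with the face lattice of B(3)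

-- vertices 0, 1, 2 are the even permutations, 3, 4, 5 the odd ones
even odd : Fin 3 → Fin 6
even p = p ↑ˡ 3
odd  n = 3 ↑ʳ n

onFacet : Fin 3 × Fin 3 → Fin 6 → Bool
onFacet (p , n) k = not (does (k Finₚ.≟ even p)) ∧ not (does (k Finₚ.≟ odd n))

facets : List (Fin 3 × Fin 3)
facets = cartesianProduct (allFin 3) (allFin 3)

_∋_ : Subset 6 → Fin 6 → Set
S ∋ k = T (lookup S k)

facetsAbove : Subset 6 → List (Fin 3 × Fin 3)
facetsAbove S = filterᵇ (λ (p , n) → not (lookup S (even p)) ∧ not (lookup S (odd n))) facets

closure : Subset 6 → Fin 6 → Bool
closure S k = does (All.all? (λ f → T? (onFacet f k)) (facetsAbove S))

-- the affine dependency of B(3) (sum of the even vertices = sum of the odd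
-- ones) forces these closure conditions on every set of tight vertices
Admissible : Subset 6 → Set
Admissible S = ((∀ n → S ∋ odd n) → ∀ p → S ∋ even p) × ((∀ p → S ∋ even p) → ∀ n → S ∋ odd n)

∀-subset? : ∀ {n} {P : Subset n → Set} → (∀ S → Dec (P S)) → Dec (∀ S → P S)
∀-subset? {zero}  P? = map′ (λ P[] → λ { [] → P[] }) (λ ∀P → ∀P []) (P? [])
∀-subset? {suc n} P? =
  map′ (λ (P⊤ , P⊥) → λ { (true ∷ S) → P⊤ S ; (false ∷ S) → P⊥ S })
       (λ ∀P → ∀P ∘ (true ∷_) , ∀P ∘ (false ∷_))
       (∀-subset? (P? ∘ (true ∷_)) ×-dec ∀-subset? (P? ∘ (false ∷_)))

closure-exact : ∀ S → Admissible S → ∀ k → closure S k ≡ lookup S k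
closure-exact = from-yes (∀-subset? λ S → admissible? S →-dec Finₚ.all? λ k → closure S k Boolₚ.≟ lookup S k)
  where
  admissible? : ∀ S → Dec (Admissible S)
  admissible? S = ((Finₚ.all? λ n → T? (lookup S (odd n))) →-dec (Finₚ.all? λ p → T? (lookup S (even p))))
          ×-dec ((Finₚ.all? λ p → T? (lookup S (even p))) →-dec (Finₚ.all? λ n → T? (lookup S (odd n))))

-- conv X with the vertices, facets and affine dependency (odd⇒even, even⇒odd) of B(3)
record B3Structure {I K : Set} (cs : List K) (X : I → K → ℚ) : Set where
  field
    vertex        : Fin 6 → K → ℚ
    type          : I → Fin 6
    type-point    : ∀ i κ → X i κ ≡ vertex (type i) κ
    witness       : Fin 6 → I
    witness-point : ∀ k κ → X (witness k) κ ≡ vertex k κ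
    normal        : Fin 3 × Fin 3 → K → ℚ
    height        : Fin 3 × Fin 3 → ℚ
    facet-valid   : ∀ f k → dot cs (normal f) (vertex k) ≤ height f
    facet-tight   : ∀ f k → does (dot cs (normal f) (vertex k) ℚₚ.≟ height f) ≡ onFacet f k
    odd⇒even      : ∀ c δ → (∀ k → dot cs c (vertex k) ≤ δ) →
                    (∀ n → dot cs c (vertex (odd n)) ≡ δ) → ∀ p → dot cs c (vertex (even p)) ≡ δ
    even⇒odd      : ∀ c δ → (∀ k → dot cs c (vertex k) ≤ δ) →
                    (∀ p → dot cs c (vertex (even p)) ≡ δ) → ∀ n → dot cs c (vertex (odd n)) ≡ δ

module _ {K : Set} (cs : List K) (vertex : Fin 6 → K → ℚ) (ps ns : List (Fin 3))
         (|ps|≡|ns| : length ps ≡ length ns)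
         (balanced : ∀ κ → ∑ ps (λ p → vertex (even p) κ) ≡ ∑ ns (λ n → vertex (odd n) κ)) where

  odd⇒even-by-dependency : (∀ p → p ∈ ps) → ∀ c δ → (∀ k → dot cs c (vertex k) ≤ δ) →
                           (∀ n → dot cs c (vertex (odd n)) ≡ δ) → ∀ p → dot cs c (vertex (even p)) ≡ δ
  odd⇒even-by-dependency ps-cover c δ valid odds p =
    balanced-tight cs ps ns (vertex ∘ even) (vertex ∘ odd) |ps|≡|ns| balanced c δ (valid ∘ even) odds (ps-cover p)

  even⇒odd-by-dependency : (∀ n → n ∈ ns) → ∀ c δ → (∀ k → dot cs c (vertex k) ≤ δ) →
                           (∀ p → dot cs c (vertex (even p)) ≡ δ) → ∀ n → dot cs c (vertex (odd n)) ≡ δ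
  even⇒odd-by-dependency ns-cover c δ valid evens n =
    balanced-tight cs ns ps (vertex ∘ odd) (vertex ∘ even) (sym |ps|≡|ns|) (sym ∘ balanced)
                   c δ (valid ∘ odd) evens (ns-cover n)

module FaceLattice {I K : Set} {cs : List K} {X : I → K → ℚ} (B : B3Structure cs X) where

  open B3Structure B

  Tight : Face cs X → Fin 6 → Set
  Tight F k = dot cs (Face.c F) (vertex k) ≡ Face.δ F

  tight? : ∀ F k → Dec (Tight F k)
  tight? F k = dot cs (Face.c F) (vertex k) ℚₚ.≟ Face.δ F

  tight : Face cs X → Subset 6
  tight F = tabulate (does ∘ tight? F)

  ∋-tight : ∀ (F : Face cs X) k → tight F ∋ k ⇔ Tight F k
  ∋-tight F k = subst (λ b → T b ⇔ Tight F k) (sym (lookup∘tabulate (does ∘ tight? F) k)) (T-does⇔ (tight? F k))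

  On⇔Tight : ∀ (F : Face cs X) i → On F i ⇔ Tight F (type i)
  On⇔Tight F i = mk⇔ (trans (sym X≡vertex)) (trans X≡vertex)
    where
    X≡vertex : dot cs (Face.c F) (X i) ≡ dot cs (Face.c F) (vertex (type i))
    X≡vertex = dot-congʳ cs (Face.c F) (type-point i)

  Tight⇔On-witness : ∀ (F : Face cs X) k → Tight F k ⇔ On F (witness k)
  Tight⇔On-witness F k = mk⇔ (trans X≡vertex) (trans (sym X≡vertex))
    where
    X≡vertex : dot cs (Face.c F) (X (witness k)) ≡ dot cs (Face.c F) (vertex k)
    X≡vertex = dot-congʳ cs (Face.c F) (witness-point k)

  valid-vertex : ∀ (F : Face cs X) k → dot cs (Face.c F) (vertex k) ≤ Face.δ F
  valid-vertex F k =
    subst (_≤ Face.δ F) (dot-congʳ cs (Face.c F) (witness-point k)) (Face.valid F (witness k))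

  tight-mono : ∀ {F G : Face cs X} → F ⊑ G → ∀ k → tight F ∋ k → tight G ∋ k
  tight-mono {F} {G} F⊑G k =
    from (∋-tight G k) ∘ from (Tight⇔On-witness G k) ∘ F⊑G (witness k)
    ∘ to (Tight⇔On-witness F k) ∘ to (∋-tight F k)
    where open Equivalence

  tight-admissible : ∀ (F : Face cs X) → Admissible (tight F)
  tight-admissible F =
    (λ odds p → from (∋-tight F (even p))
                     (odd⇒even c δ (valid-vertex F) (λ n → to (∋-tight F (odd n)) (odds n)) p)) ,
    (λ evens n → from (∋-tight F (odd n))
                      (even⇒odd c δ (valid-vertex F) (λ p → to (∋-tight F (even p)) (evens p)) n))
    where
    open Equivalence
    open Face F

  face : Subset 6 → Face cs X
  face S = record
    { c     = λ κ → ∑ (facetsAbove S) (λ f → normal f κ)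
    ; δ     = ∑ (facetsAbove S) height
    ; valid = λ i → subst (_≤ ∑ (facetsAbove S) height)
                          (sym (trans (dot-congʳ cs (λ κ → ∑ (facetsAbove S) (λ f → normal f κ)) (type-point i))
                                      (dot-∑ˡ cs (facetsAbove S) normal (vertex (type i)))))
                          (∑-mono-≤ (facetsAbove S) (λ f → facet-valid f (type i))) }

  -- a sum of valid inequalities is tight exactly where all of them are
  Tight-face⇔closure : ∀ S k → Tight (face S) k ⇔ T (closure S k)
  Tight-face⇔closure S k = mk⇔
    (λ tight-k → from closure⇔ (All.tabulate λ {f} f∈ → to (on⇔ f)
                   (∑-tight (facetsAbove S) (λ f → facet-valid f k) (trans (sym ∑≡) tight-k) f∈)))
    (λ closed → trans ∑≡ (∑-cong (facetsAbove S) λ {f} f∈ → from (on⇔ f) (All.lookup (to closure⇔ closed) f∈)))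
    where
    open Equivalence
    ∑≡ : dot cs (Face.c (face S)) (vertex k) ≡ ∑ (facetsAbove S) (λ f → dot cs (normal f) (vertex k))
    ∑≡ = dot-∑ˡ cs (facetsAbove S) normal (vertex k)
    closure⇔ : T (closure S k) ⇔ All (λ f → T (onFacet f k)) (facetsAbove S)
    closure⇔ = T-does⇔ (All.all? (λ f → T? (onFacet f k)) (facetsAbove S))
    on⇔ : ∀ f → dot cs (normal f) (vertex k) ≡ height f ⇔ T (onFacet f k)
    on⇔ f = subst (λ b → dot cs (normal f) (vertex k) ≡ height f ⇔ T b) (facet-tight f k)
                  (⇔-sym (T-does⇔ (dot cs (normal f) (vertex k) ℚₚ.≟ height f)))

  Tight-face : ∀ S → Admissible S → ∀ k → Tight (face S) k ⇔ S ∋ k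
  Tight-face S adm k =
    subst (λ b → Tight (face S) k ⇔ T b) (closure-exact S adm k) (Tight-face⇔closure S k)

  On-face : ∀ S → Admissible S → ∀ i → On (face S) i ⇔ S ∋ type i
  On-face S adm i = Tight-face S adm (type i) ⇔-∘ On⇔Tight (face S) i

module Transport {I K J L : Set} {cs : List K} {X : I → K → ℚ} {ds : List L} {Y : J → L → ℚ}
                 (𝔸 : B3Structure cs X) (𝔹 : B3Structure ds Y) where

  private
    module A = FaceLattice 𝔸
    module B = FaceLattice 𝔹
    open Equivalence

  transport : Face cs X → Face ds Y
  transport = B.face ∘ A.tight

  tight-transport : ∀ F k → B.tight (transport F) ∋ k ⇔ A.tight F ∋ k
  tight-transport F k = B.Tight-face (A.tight F) (A.tight-admissible F) k ⇔-∘ B.∋-tight (transport F) k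

  transport-mono : ∀ (F G : Face cs X) → F ⊑ G → transport F ⊑ transport G
  transport-mono F G F⊑G j =
    from (B.On-face (A.tight G) (A.tight-admissible G) j) ∘ A.tight-mono {F} {G} F⊑G (B3Structure.type 𝔹 j)
    ∘ to (B.On-face (A.tight F) (A.tight-admissible F) j)

  transport-back : ∀ F → A.face (B.tight (transport F)) ≈F F
  transport-back F = (λ i → to (round-trip {i})) , (λ i → from (round-trip {i}))
    where
    round-trip : ∀ {i} → On (A.face (B.tight (transport F))) i ⇔ On F i
    round-trip {i} = ⇔-sym (A.On⇔Tight F i)
                 ⇔-∘ (A.∋-tight F (B3Structure.type 𝔸 i)
                 ⇔-∘ (tight-transport F (B3Structure.type 𝔸 i)
                 ⇔-∘ A.On-face (B.tight (transport F)) (B.tight-admissible (transport F)) i))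

combEquiv-B3 : ∀ {I K J L : Set} {cs : List K} {X : I → K → ℚ} {ds : List L} {Y : J → L → ℚ} →
               B3Structure cs X → B3Structure ds Y → CombEquiv cs X ds Y
combEquiv-B3 𝔸 𝔹 =
  transport , T.transport , transport-mono , T.transport-mono , transport-back , T.transport-back
  where
  open Transport 𝔸 𝔹
  module T = Transport 𝔹 𝔸

-- The Birkhoff polytope

-- the six permutations of Fin 3, even ones first
perm : Fin 6 → Fin 3 → Fin 3
perm k = lookup (lookup table k)
  where
  table : Vec (Vec (Fin 3) 3) 6
  table = (# 0 ∷ # 1 ∷ # 2 ∷ []) ∷ (# 1 ∷ # 2 ∷ # 0 ∷ []) ∷ (# 2 ∷ # 0 ∷ # 1 ∷ [])
        ∷ (# 0 ∷ # 2 ∷ # 1 ∷ []) ∷ (# 2 ∷ # 1 ∷ # 0 ∷ []) ∷ (# 1 ∷ # 0 ∷ # 2 ∷ []) ∷ []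

inverse : Fin 6 → Fin 6
inverse = lookup (# 0 ∷ # 2 ∷ # 1 ∷ # 3 ∷ # 4 ∷ # 5 ∷ [])

perm-inverseˡ : ∀ k i → perm k (perm (inverse k) i) ≡ i
perm-inverseˡ = from-yes (Finₚ.all? λ k → Finₚ.all? λ i → perm k (perm (inverse k) i) Finₚ.≟ i)

perm-inverseʳ : ∀ k i → perm (inverse k) (perm k i) ≡ i
perm-inverseʳ = from-yes (Finₚ.all? λ k → Finₚ.all? λ i → perm (inverse k) (perm k i) Finₚ.≟ i)

asPermutation : Fin 6 → Permutation′ 3
asPermutation k = permutation (perm k) (perm (inverse k)) (perm-inverseˡ k) (perm-inverseʳ k)

perm-complete : ∀ x y z → x ≢ y → y ≢ z → x ≢ z →
                ∃ λ k → perm k (# 0) ≡ x × perm k (# 1) ≡ y × perm k (# 2) ≡ z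
perm-complete = from-yes
  (Finₚ.all? λ x → Finₚ.all? λ y → Finₚ.all? λ z →
   ¬? (x Finₚ.≟ y) →-dec ¬? (y Finₚ.≟ z) →-dec ¬? (x Finₚ.≟ z) →-dec
   Finₚ.any? λ k → (perm k (# 0) Finₚ.≟ x) ×-dec (perm k (# 1) Finₚ.≟ y) ×-dec (perm k (# 2) Finₚ.≟ z))

matrix : (Fin 3 → Fin 3) → Fin 3 × Fin 3 → ℚ
matrix σ (i , j) = if does (σ i Finₚ.≟ j) then 1ℚ else 0ℚ

module _ (π : Permutation′ 3) where

  private
    π-injective : ∀ {i j} → π ⟨$⟩ʳ i ≡ π ⟨$⟩ʳ j → i ≡ j
    π-injective {i} {j} eq = trans (sym (inverseˡ π)) (trans (cong (π ⟨$⟩ˡ_) eq) (inverseˡ π))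

    found : ∃ λ k → perm k (# 0) ≡ π ⟨$⟩ʳ # 0 × perm k (# 1) ≡ π ⟨$⟩ʳ # 1 × perm k (# 2) ≡ π ⟨$⟩ʳ # 2
    found = perm-complete (π ⟨$⟩ʳ # 0) (π ⟨$⟩ʳ # 1) (π ⟨$⟩ʳ # 2)
                          (λ eq → case π-injective eq of λ ()) (λ eq → case π-injective eq of λ ())
                          (λ eq → case π-injective eq of λ ())

  permIndex : Fin 6
  permIndex = proj₁ found

  perm-permIndex : ∀ i → perm permIndex i ≡ π ⟨$⟩ʳ i
  perm-permIndex zero             = proj₁ (proj₂ found)
  perm-permIndex (suc zero)       = proj₁ (proj₂ (proj₂ found))
  perm-permIndex (suc (suc zero)) = proj₂ (proj₂ (proj₂ found))

birkhoff : B3Structure (pairsAll 3) permMatrix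
birkhoff = record
  { vertex        = vertex
  ; type          = permIndex
  ; type-point    = λ π (i , j) → cong (λ x → if does (x Finₚ.≟ j) then 1ℚ else 0ℚ) (sym (perm-permIndex π i))
  ; witness       = asPermutation
  ; witness-point = λ _ _ → refl
  ; normal        = normal
  ; height        = λ _ → 0ℚ
  ; facet-valid   = λ (p , n) → facet-valid p n
  ; facet-tight   = λ (p , n) → facet-tight p n
  ; odd⇒even      = odd⇒even-by-dependency cs vertex (allFin 3) (allFin 3) refl balanced ∈-allFin
  ; even⇒odd      = even⇒odd-by-dependency cs vertex (allFin 3) (allFin 3) refl balanced ∈-allFin
  }
  where
  cs : List (Fin 3 × Fin 3)
  cs = pairsAll 3

  vertex : Fin 6 → Fin 3 × Fin 3 → ℚ
  vertex = matrix ∘ perm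

  -- −x_ij for the one entry (i , j) where the two permutations agree
  normal : Fin 3 × Fin 3 → Fin 3 × Fin 3 → ℚ
  normal (p , n) κ = - (vertex (even p) κ * vertex (odd n) κ)

  facet-valid : ∀ p n k → dot cs (normal (p , n)) (vertex k) ≤ 0ℚ
  facet-valid = from-yes (Finₚ.all? λ p → Finₚ.all? λ n → Finₚ.all? λ k →
                  dot cs (normal (p , n)) (vertex k) ℚₚ.≤? 0ℚ)

  facet-tight : ∀ p n k → does (dot cs (normal (p , n)) (vertex k) ℚₚ.≟ 0ℚ) ≡ onFacet (p , n) k
  facet-tight = from-yes (Finₚ.all? λ p → Finₚ.all? λ n → Finₚ.all? λ k →
                  does (dot cs (normal (p , n)) (vertex k) ℚₚ.≟ 0ℚ) Boolₚ.≟ onFacet (p , n) k)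

  balanced : ∀ κ → ∑ (allFin 3) (λ p → vertex (even p) κ) ≡ ∑ (allFin 3) (λ n → vertex (odd n) κ)
  balanced (i , j) = from-yes (Finₚ.all? λ i → Finₚ.all? λ j →
                       ∑ (allFin 3) (λ p → vertex (even p) (i , j)) ℚₚ.≟ ∑ (allFin 3) (λ n → vertex (odd n) (i , j)))
                     i j

-- The facet of P₅

caterpillarPoint : (Fin 5 → Fin 3) → Fin 5 × Fin 5 → ℚ
caterpillarPoint pos (i , j) = ℕ→ℚ (2 ^ (5 ∸ 2 ∸ Caterpillar.catℓ pos i j))

-- the two leaves besides a, b and c (junk values unless a, b, c are distinct)
remaining : Fin 5 → Fin 5 → Fin 5 → Fin 5 × Fin 5
remaining a b c with filter (λ x → ¬? (x ∈? a ∷ b ∷ c ∷ [])) (allFin 5)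
... | d ∷ e ∷ _ = d , e
... | _         = a , a

caterpillarOf : Fin 5 × Fin 5 × Fin 5 → Fin 5 → Fin 3
caterpillarOf (x , y , z) = cherryPos x y z

module FacetData (a b c : Fin 5) where

  d e : Fin 5
  d = proj₁ (remaining a b c)
  e = proj₂ (remaining a b c)

  -- (x , y , z) stands for the caterpillar with cherry {x,y} and middle leaf z
  label : Fin 6 → Fin 5 × Fin 5 × Fin 5
  label = lookup ((a , b , c) ∷ (b , c , d) ∷ (b , c , e) ∷ (a , b , d) ∷ (a , b , e) ∷ (b , c , a) ∷ [])

  positions : Fin 6 → Fin 5 → Fin 3
  positions k = caterpillarOf (label k)

  vertex : Fin 6 → Fin 5 × Fin 5 → ℚ
  vertex k = caterpillarPoint (positions k)

  x[_,_] : Fin 5 → Fin 5 → Fin 5 × Fin 5 → ℚ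
  x[ u , v ] (i , j) =
    if does (i Finₚ.≟ u) ∧ does (j Finₚ.≟ v) ∨ does (i Finₚ.≟ v) ∧ does (j Finₚ.≟ u) then 1ℚ else 0ℚ

  -- facet (p , n) is the hyperplane through the four vertices other than even p and odd n
  normal : Fin 3 × Fin 3 → Fin 5 × Fin 5 → ℚ
  normal (zero             , zero            ) κ = x[ b , e ] κ - x[ c , e ] κ
  normal (suc zero         , zero            ) κ = - x[ b , d ] κ
  normal (suc (suc zero)   , zero            ) κ = - x[ a , d ] κ - x[ c , e ] κ
  normal (zero             , suc zero        ) κ = x[ b , d ] κ - x[ c , d ] κ
  normal (suc zero         , suc zero        ) κ = - x[ a , e ] κ - x[ c , d ] κ
  normal (suc (suc zero)   , suc zero        ) κ = - x[ b , e ] κ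
  normal (zero             , suc (suc zero)  ) κ = - x[ a , c ] κ
  normal (suc zero         , suc (suc zero)  ) κ = x[ b , e ] κ - x[ a , e ] κ
  normal (suc (suc zero)   , suc (suc zero)  ) κ = x[ b , d ] κ - x[ a , d ] κ

  height : Fin 3 × Fin 3 → ℚ
  height (zero             , zero            ) = 0ℚ
  height (suc zero         , zero            ) = - 1ℚ
  height (suc (suc zero)   , zero            ) = - ℕ→ℚ 3
  height (zero             , suc zero        ) = 0ℚ
  height (suc zero         , suc zero        ) = - ℕ→ℚ 3
  height (suc (suc zero)   , suc zero        ) = - 1ℚ
  height (zero             , suc (suc zero)  ) = - 1ℚ
  height (suc zero         , suc (suc zero)  ) = 0ℚ
  height (suc (suc zero)   , suc (suc zero)  ) = 0ℚ

  -- 3 v(ab|c) + v(bc|d) + v(bc|e) = v(ab|d) + v(ab|e) + 3 v(bc|a)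
  evens odds : List (Fin 3)
  evens = # 0 ∷ # 0 ∷ # 0 ∷ # 1 ∷ # 2 ∷ []
  odds  = # 0 ∷ # 1 ∷ # 2 ∷ # 2 ∷ # 2 ∷ []

  open Finₚ using (all?; any?)

  FacetsValid : Set
  FacetsValid = ∀ p n k → dot (pairs< 5) (normal (p , n)) (vertex k) ≤ height (p , n)

  FacetsTight : Set
  FacetsTight = ∀ p n k → does (dot (pairs< 5) (normal (p , n)) (vertex k) ℚₚ.≟ height (p , n))
                         ≡ onFacet (p , n) k

  Balanced : Set
  Balanced = ∀ i j → ∑ evens (λ p → vertex (even p) (i , j)) ≡ ∑ odds (λ n → vertex (odd n) (i , j))

  Trivalent : Set
  Trivalent = ∀ k x → degree (caterpillarAdj (positions k)) (inj₂ x) ≡ 3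

  Labelled : Fin 5 → Fin 5 → Set
  Labelled x y = ∀ z → z ≢ x → z ≢ y → ∃ λ k → label k ≡ (x , y , z)

  Facts : Set
  Facts = FacetsValid × FacetsTight × Balanced × Trivalent × Labelled a b × Labelled b c

  facts? : Dec Facts
  facts? = (all? λ p → all? λ n → all? λ k → dot (pairs< 5) (normal (p , n)) (vertex k) ℚₚ.≤? height (p , n))
     ×-dec (all? λ p → all? λ n → all? λ k →
              does (dot (pairs< 5) (normal (p , n)) (vertex k) ℚₚ.≟ height (p , n)) Boolₚ.≟ onFacet (p , n) k)
     ×-dec (all? λ i → all? λ j →
              ∑ evens (λ p → vertex (even p) (i , j)) ℚₚ.≟ ∑ odds (λ n → vertex (odd n) (i , j)))
     ×-dec (all? λ k → all? λ x → degree (caterpillarAdj (positions k)) (inj₂ x) ℕₚ.≟ 3)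
     ×-dec labelled? a b ×-dec labelled? b c
    where
    labelled? : ∀ x y → Dec (Labelled x y)
    labelled? x y =
      all? λ z → ¬? (z Finₚ.≟ x) →-dec ¬? (z Finₚ.≟ y) →-dec any? λ k → ≟-triple (label k) (x , y , z)
      where
      ≟-triple : DecidableEquality (Fin 5 × Fin 5 × Fin 5)
      ≟-triple = ×-≡-dec Finₚ._≟_ (×-≡-dec Finₚ._≟_ Finₚ._≟_)

facet-facts : ∀ a b c → a ≢ b → b ≢ c → a ≢ c → FacetData.Facts a b c
facet-facts = from-yes (all? λ a → all? λ b → all? λ c →
  ¬? (a Finₚ.≟ b) →-dec ¬? (b Finₚ.≟ c) →-dec ¬? (a Finₚ.≟ c) →-dec FacetData.facts? a b c)
  where open Finₚ using (all?)

cherryPos-first : ∀ x y z → cherryPos x y z x ≡ zero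
cherryPos-first x y z =
  cong (λ b → position (b ∨ does (x Finₚ.≟ y)) (does (x Finₚ.≟ z))) (dec-true (x Finₚ.≟ x) refl)

cherryPos-second : ∀ x y z → cherryPos x y z y ≡ zero
cherryPos-second x y z =
  cong (λ b → position b (does (y Finₚ.≟ z)))
       (trans (cong (does (y Finₚ.≟ x) ∨_) (dec-true (y Finₚ.≟ y) refl)) (∨-zeroʳ _))

cherry-caterpillar : ∀ x y z deg → Cherry (Caterpillar.caterpillar (cherryPos x y z) deg) x y
cherry-caterpillar x y z _ =
  zero , dec-true (_ Finₚ.≟ zero) (cherryPos-first x y z) , dec-true (_ Finₚ.≟ zero) (cherryPos-second x y z)

vertex-of-label : ∀ {a b c k x y z} → FacetData.label a b c k ≡ (x , y , z) →
                  ∀ κ → caterpillarPoint (cherryPos x y z) κ ≡ FacetData.vertex a b c k κ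
vertex-of-label label≡ κ = cong (λ l → caterpillarPoint (caterpillarOf l) κ) (sym label≡)

xvec-caterpillar : ∀ (t : BinTree 5) {pos} → (∀ i j → ℓ t i j ≡ Caterpillar.catℓ pos i j) →
                   ∀ κ → xvec t κ ≡ caterpillarPoint pos κ
xvec-caterpillar t ℓ≡ (i , j) = cong (λ l → ℕ→ℚ (2 ^ (5 ∸ 2 ∸ l))) (ℓ≡ i j)

module FacetStructure (a b c : Fin 5) (a≢b : a ≢ b) (b≢c : b ≢ c) (facts : FacetData.Facts a b c) where
  open FacetData a b c

  private
    valid : FacetsValid
    valid = proj₁ facts
    tight : FacetsTight
    tight = proj₁ (proj₂ facts)
    balanced : Balanced
    balanced = proj₁ (proj₂ (proj₂ facts))
    trivalent : Trivalent
    trivalent = proj₁ (proj₂ (proj₂ (proj₂ facts)))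
    ab-labelled : Labelled a b
    ab-labelled = proj₁ (proj₂ (proj₂ (proj₂ (proj₂ facts))))
    bc-labelled : Labelled b c
    bc-labelled = proj₂ (proj₂ (proj₂ (proj₂ (proj₂ facts))))

  caterpillar : Fin 6 → BinTree 5
  caterpillar k = Caterpillar.caterpillar (positions k) (trivalent k)

  side : ∀ k → Cherry (caterpillar k) a b ⊎ Cherry (caterpillar k) b c
  side k@zero                               = inj₁ (cherry-caterpillar a b c (trivalent k))
  side k@(suc zero)                         = inj₂ (cherry-caterpillar b c d (trivalent k))
  side k@(suc (suc zero))                   = inj₂ (cherry-caterpillar b c e (trivalent k))
  side k@(suc (suc (suc zero)))             = inj₁ (cherry-caterpillar a b d (trivalent k))
  side k@(suc (suc (suc (suc zero))))       = inj₁ (cherry-caterpillar a b e (trivalent k))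
  side k@(suc (suc (suc (suc (suc zero))))) = inj₂ (cherry-caterpillar b c a (trivalent k))

  classify : ∀ {x y} (t : BinTree 5) → x ≢ y → Cherry t x y → Labelled x y → ∃ λ k → ∀ κ → xvec t κ ≡ vertex k κ
  classify t x≢y cherry labelled =
    let (z , z≢x , z≢y , ℓ≡) = cherry⇒caterpillar t x≢y cherry
        (k , label≡)         = labelled z z≢x z≢y
    in k , λ κ → trans (xvec-caterpillar t ℓ≡ κ) (vertex-of-label {a} {b} {c} {k} label≡ κ)

  typed : (T : FacetTrees a b c) → ∃ λ k → ∀ κ → facetPts a b c T κ ≡ vertex k κ
  typed (t , inj₁ cherry) = classify t a≢b cherry ab-labelled
  typed (t , inj₂ cherry) = classify t b≢c cherry bc-labelled

  evens-cover : ∀ p → p ∈ evens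
  evens-cover zero             = here refl
  evens-cover (suc zero)       = there (there (there (here refl)))
  evens-cover (suc (suc zero)) = there (there (there (there (here refl))))

  odds-cover : ∀ n → n ∈ odds
  odds-cover zero             = here refl
  odds-cover (suc zero)       = there (here refl)
  odds-cover (suc (suc zero)) = there (there (here refl))

  structure : B3Structure (pairs< 5) (facetPts a b c)
  structure = record
    { vertex        = vertex
    ; type          = λ T → proj₁ (typed T)
    ; type-point    = λ T → proj₂ (typed T)
    ; witness       = λ k → caterpillar k , side k
    ; witness-point = λ k → xvec-caterpillar (caterpillar k) (Caterpillar.ℓ-caterpillar (positions k) (trivalent k))
    ; normal        = normal
    ; height        = height
    ; facet-valid   = λ (p , n) → valid p n
    ; facet-tight   = λ (p , n) → tight p n
    ; odd⇒even      = odd⇒even-by-dependency (pairs< 5) vertex evens odds refl (λ (i , j) → balanced i j) evens-cover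
    ; even⇒odd      = even⇒odd-by-dependency (pairs< 5) vertex evens odds refl (λ (i , j) → balanced i j) odds-cover
    }

theorem3 : (a b c : Fin 5) → a ≢ b → b ≢ c → a ≢ c →
           CombEquiv (pairs< 5) (facetPts a b c) (pairsAll 3) permMatrix
theorem3 a b c a≢b b≢c a≢c =
  combEquiv-B3 (FacetStructure.structure a b c a≢b b≢c (facet-facts a b c a≢b b≢c a≢c)) birkhoff
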